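{- Let $e_1, e_2\geq 0$ be two integers. Then a GDP$(M,3^{e_1}2^{e_2})$ exists for all $M\geq 6e_1+2e_2+1$ except when $e_1 \equiv 2\text{ or } 3\pmod {4}$ and $(M,e_2)=(6e_1+2,0)$.
   Context: A GDP$(M,3^{e_1}2^{e_2})$ (generalized difference packing) is a collection of $e_1$ subsets of size $3$ and $e_2$ subsets of size $2$ of $\mathbb{Z}_M$ (base blocks) such that every nonzero element of $\mathbb{Z}_M$ occurs at most once in the multiset of differences $b-b'$ with $b\neq b'$ in a common base block. -}

module Defs where

open import Data.Nat using (ℕ; _+_; _∸_; _*_; _≤ᵇ_; _%_)
open import Data.Bool using (if_then_else_)
open import Data.Fin using (Fin; toℕ)
open import Data.Product using (_×_; _,_)
open import Data.Sum using (_⊎_)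
open import Data.List using (List; []; _∷_; _++_; concatMap)
open import Data.Vec using (Vec; toList)
open import Data.Vec.Relation.Unary.All using (All)
open import Data.List.Relation.Unary.Unique.Propositional using (Unique)
open import Relation.Binary.PropositionalEquality using (_≡_; _≢_)

-- difference a - b in ℤ_M, represented by its canonical residue in {0,…,M-1}
diffZ : (M : ℕ) → Fin M → Fin M → ℕ
diffZ M a b = if toℕ b ≤ᵇ toℕ a then toℕ a ∸ toℕ b else (M + toℕ a) ∸ toℕ b

-- a 3-subset {a,b,c} of ℤ_M given by three pairwise distinct elements
Triple : ℕ → Set
Triple M = Fin M × Fin M × Fin M

Pair : ℕ → Set
Pair M = Fin M × Fin M

IsTriple : {M : ℕ} → Triple M → Set
IsTriple (a , b , c) = (a ≢ b) × (a ≢ c) × (b ≢ c)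

IsPair : {M : ℕ} → Pair M → Set
IsPair (a , b) = a ≢ b

triDiffs : (M : ℕ) → Triple M → List ℕ
triDiffs M (a , b , c) =
  diffZ M a b ∷ diffZ M b a ∷ diffZ M a c ∷ diffZ M c a ∷ diffZ M b c ∷ diffZ M c b ∷ []

pairDiffs : (M : ℕ) → Pair M → List ℕ
pairDiffs M (a , b) = diffZ M a b ∷ diffZ M b a ∷ []

-- GDP(M, 3^e₁ 2^e₂): e₁ base blocks of size 3 and e₂ of size 2 in ℤ_M such that
-- every nonzero element occurs at most once in the multiset of differences,
-- i.e. the list of all differences has no repetitions.
record GDP (M e₁ e₂ : ℕ) : Set where
  field
    triples   : Vec (Triple M) e₁
    pairs     : Vec (Pair M) e₂
    triplesOk : All IsTriple triples
    pairsOk   : All IsPair pairs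
    packing   : Unique (concatMap (triDiffs M) (toList triples)
                          ++ concatMap (pairDiffs M) (toList pairs))

Exceptional : ℕ → ℕ → ℕ → Set
Exceptional M e₁ e₂ = ((e₁ % 4 ≡ 2) ⊎ (e₁ % 4 ≡ 3)) × (M ≡ 6 * e₁ + 2) × (e₂ ≡ 0)

-- The base block {0, x, x + y} has the differences ±x, ±y, ±(x + y) and {0, p}
-- has ±p; so it suffices to find difference triples x + y ≡ ±z (mod M) and single values p
-- whose small representatives (0 < v < M/2) are pairwise distinct (gdpFromTriples).  A
-- Skolem sequence of order n, given by its position pairs (a, b) with b − a running through
-- 1, …, n, yields the triples (b − a, n + a, n + b) with values exactly 1, …, 3n; a hooked
-- one gives 1, …, 3n − 1 and 3n + 1.  For M ≥ 6n + 1 (and M ≠ 6n + 2 in the hooked case)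
-- their representatives stay distinct, and e₂ more values are found among 1, …, 3n + e₂ by
-- counting (FromSkolem).  Skolem sequences exist for n ≡ 0, 1 and hooked ones for n ≡ 2, 3
-- (mod 4); they are assembled from nested families of pairs whose parameters are affine in
-- n, and the side conditions are verified by a boolean check proved sound (Certificate).
--
-- In ℤ_{2m} the difference a − b has the parity of a + b, so every block has
-- 0 or 4 odd differences.  For M = 6e₁ + 2 = 2m the 6e₁ distinct nonzero differences contain
-- at most m odd and m − 1 even residues, so their number 4K of odd ones is 3e₁ or 3e₁ + 1,
-- which is impossible for e₁ ≡ 2, 3 (mod 4).

module Submission where

open import Defs
open import Data.Nat using (ℕ; zero; suc; _+_; _*_; _≤_; _∸_; _<_; z≤n; s≤s; _≤ᵇ_; _≡ᵇ_; _≟_; _≤?_; _<?_; _%_; ⌊_/2⌋)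
open import Data.Nat.Properties
open import Data.Nat.DivMod using (_/_; [m+kn]%n≡m%n; m<n⇒m%n≡m; m%n<n; m≡m%n+[m/n]*n; m*n%n≡0; %-distribˡ-+; %-distribˡ-*)
open import Data.Nat.ListAction using (sum)
open import Data.Nat.ListAction.Properties using (sum-++)
open import Data.Nat.Tactic.RingSolver using (solve-∀)
open import Data.Bool using (Bool; true; false; _∧_; _∨_; not; T)
open import Data.Bool.Properties using (T-∧; T-∨; T-≡)
open import Data.List using (List; []; _∷_; _++_; concatMap; map; length; filter; take; applyUpTo; downFrom)
open import Data.Bool.ListAction using (all)
open import Data.List.Properties using (length-take; length-applyUpTo; length-map; length-++; length-downFrom; map-++; filter-accept; filter-reject; ++-identityʳ)
open import Data.List.Relation.Unary.All as All using (All; []; _∷_)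
import Data.List.Relation.Unary.All.Properties as AllP
open import Data.List.Relation.Unary.AllPairs as AllPairs using (AllPairs; []; _∷_)
import Data.List.Relation.Unary.AllPairs.Properties as AllPairsP
open import Data.List.Relation.Binary.Disjoint.Propositional using (Disjoint)
open import Data.List.Relation.Unary.Any using (here; there)
open import Data.List.Membership.Propositional using (_∈_; _∉_)
open import Data.List.Membership.Propositional.Properties using (∈-filter⁻; ∈-filter⁺; ∈-applyUpTo⁻; ∈-downFrom⁺)
open import Data.List.Membership.DecPropositional _≟_ using (_∈?_)
open import Data.List.Relation.Unary.Unique.Propositional using (Unique)
import Data.List.Relation.Unary.Unique.Propositional.Properties as UP
open import Data.Vec as V using (Vec; toList)
import Data.Vec.Relation.Unary.All as VA
open import Data.Fin using (Fin; toℕ; fromℕ<)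
open import Data.Fin.Properties using (toℕ-fromℕ<; toℕ<n; toℕ-injective)
open import Data.Product using (∃; _×_; _,_; proj₁; proj₂)
open import Data.Sum as Sum using (_⊎_; inj₁; inj₂)
open import Data.Empty using (⊥; ⊥-elim)
open import Data.Unit using (tt)
open import Function using (_∘_; Equivalence)
open import Relation.Binary.PropositionalEquality
open import Relation.Binary using (tri<; tri≈; tri>)
open import Relation.Nullary using (¬_; Dec; yes; no; contradiction)
open import Relation.Unary using (Decidable)
open import Relation.Unary.Properties using (∁?)

diffZ-≥ : ∀ {M} (a b : Fin M) → toℕ b ≤ toℕ a → diffZ M a b ≡ toℕ a ∸ toℕ b
diffZ-≥ a b b≤a with toℕ b ≤ᵇ toℕ a | ≤⇒≤ᵇ b≤a
... | true  | _  = refl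
... | false | ()

diffZ-< : ∀ {M} (a b : Fin M) → toℕ a < toℕ b → diffZ M a b ≡ M + toℕ a ∸ toℕ b
diffZ-< a b a<b with toℕ b ≤ᵇ toℕ a | ≤ᵇ⇒≤ (toℕ b) (toℕ a)
... | false | _   = refl
... | true  | b≤a = ⊥-elim (<⇒≱ a<b (b≤a _))

-- v is small modulo M when 0 < v and 2v < M; the residues ±v are then nonzero and distinct.
Small : ℕ → ℕ → Set
Small M v = 1 ≤ v × v + v < M

Signed : ℕ → ℕ → ℕ → Set
Signed M c v = v ≡ c ⊎ v ≡ M ∸ c

small⇒≤ : ∀ {M c} → c + c < M → c ≤ M
small⇒≤ {M} {c} h = ≤-trans (m≤m+n c c) (<⇒≤ h)

-- A small number is never the negative of a small number: c ≡ M − c' forces M = c + c'.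
small≢neg : ∀ {M c c'} → c + c < M → c' + c' < M → c ≢ M ∸ c'
small≢neg {M} {c} {c'} h h' c≡ = <-irrefl (sym double) (+-mono-< h h')
  where
    M≡ : M ≡ c + c'
    M≡ = trans (sym (m∸n+n≡m (small⇒≤ {M} {c'} h'))) (cong (_+ c') (sym c≡))
    interchange : ∀ a b → (a + b) + (a + b) ≡ (a + a) + (b + b)
    interchange = solve-∀
    double : M + M ≡ (c + c) + (c' + c')
    double = trans (cong₂ _+_ M≡ M≡) (interchange c c')

signed-injective : ∀ {M c c' v} → c + c < M → c' + c' < M → Signed M c v → Signed M c' v → c ≡ c'
signed-injective _ _ (inj₁ refl) (inj₁ refl) = refl
signed-injective {M} {c} {c'} h h' (inj₁ refl) (inj₂ e) = ⊥-elim (small≢neg {M} {c} {c'} h h' e)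
signed-injective {M} {c} {c'} h h' (inj₂ e) (inj₁ refl) = ⊥-elim (small≢neg {M} {c'} {c} h' h e)
signed-injective {M} {c} {c'} h h' (inj₂ e) (inj₂ e') =
  ∸-cancelˡ-≡ (small⇒≤ {M} {c} h) (small⇒≤ {M} {c'} h') (trans (sym e) e')

-- es lists, for each c of cs in turn, the two residues c and M − c in either order.
-- This is the shape of the list of differences of the base blocks built below.
data SignedCopies (M : ℕ) : List ℕ → List ℕ → Set where
  none    : SignedCopies M [] []
  neg-pos : ∀ {c a b cs es} → a ≡ M ∸ c → b ≡ c → SignedCopies M cs es →
            SignedCopies M (c ∷ cs) (a ∷ b ∷ es)
  pos-neg : ∀ {c a b cs es} → a ≡ c → b ≡ M ∸ c → SignedCopies M cs es →
            SignedCopies M (c ∷ cs) (a ∷ b ∷ es)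

signedCopies-∈ : ∀ {M cs es v} → SignedCopies M cs es → v ∈ es → ∃ λ c → c ∈ cs × Signed M c v
signedCopies-∈ (neg-pos a≡ _ _)  (here refl)         = _ , here refl , inj₂ a≡
signedCopies-∈ (neg-pos _ b≡ _)  (there (here refl)) = _ , here refl , inj₁ b≡
signedCopies-∈ (pos-neg a≡ _ _)  (here refl)         = _ , here refl , inj₁ a≡
signedCopies-∈ (pos-neg _ b≡ _)  (there (here refl)) = _ , here refl , inj₂ b≡
signedCopies-∈ (neg-pos _ _ sc)  (there (there v∈)) with c , c∈ , s ← signedCopies-∈ sc v∈ = c , there c∈ , s
signedCopies-∈ (pos-neg _ _ sc)  (there (there v∈)) with c , c∈ , s ← signedCopies-∈ sc v∈ = c , there c∈ , s

signed-fresh : ∀ {M c v cs es} → All (Small M) (c ∷ cs) → c ∉ cs → SignedCopies M cs es →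
               Signed M c v → All (v ≢_) es
signed-fresh {M} {c} {v} (sc ∷ scs) c∉ copies sv = All.tabulate avoids
  where
    avoids : ∀ {w} → w ∈ _ → v ≢ w
    avoids w∈ refl with c' , c'∈ , sw ← signedCopies-∈ copies w∈ =
      c∉ (subst (_∈ _) (sym (signed-injective {M} {c} {c'} (proj₂ sc) (proj₂ (All.lookup scs c'∈)) sv sw)) c'∈)

signedCopies-unique : ∀ {M cs es} → SignedCopies M cs es → Unique cs → All (Small M) cs → Unique es
signedCopies-unique none [] [] = []
signedCopies-unique {M} (neg-pos {c} refl refl copies) (c≢ ∷ u) (sc ∷ scs) =
  (small≢neg {M} {c} {c} (proj₂ sc) (proj₂ sc) ∘ sym ∷ fresh (inj₂ refl)) ∷ fresh (inj₁ refl)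
  ∷ signedCopies-unique copies u scs
  where
    fresh : ∀ {v} → Signed _ _ v → All (v ≢_) _
    fresh = signed-fresh (sc ∷ scs) (AllP.All¬⇒¬Any c≢) copies
signedCopies-unique {M} (pos-neg {c} refl refl copies) (c≢ ∷ u) (sc ∷ scs) =
  (small≢neg {M} {c} {c} (proj₂ sc) (proj₂ sc) ∷ fresh (inj₁ refl)) ∷ fresh (inj₂ refl)
  ∷ signedCopies-unique copies u scs
  where
    fresh : ∀ {v} → Signed _ _ v → All (v ≢_) _
    fresh = signed-fresh (sc ∷ scs) (AllP.All¬⇒¬Any c≢) copies

signedCopies-++ : ∀ {M cs es cs' es'} → SignedCopies M cs es → SignedCopies M cs' es' →
                  SignedCopies M (cs ++ cs') (es ++ es')
signedCopies-++ none             rest = rest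
signedCopies-++ (neg-pos a b sc) rest = neg-pos a b (signedCopies-++ sc rest)
signedCopies-++ (pos-neg a b sc) rest = pos-neg a b (signedCopies-++ sc rest)

DiffTriple : ℕ → ℕ × ℕ × ℕ → Set
DiffTriple M (x , y , z) = x + y ≡ z ⊎ x + y + z ≡ M

-- The values x, z, y of each triple, in the order in which the block {0, x, x + y} produces
-- them as differences.
tripleValues : List (ℕ × ℕ × ℕ) → List ℕ
tripleValues []                = []
tripleValues ((x , y , z) ∷ ts) = x ∷ z ∷ y ∷ tripleValues ts

-- Construction of a GDP from difference triples (x , y , z), giving blocks {0, x, x + y},
-- and single values p, giving blocks {0, p}: the differences are the signed copies of the
-- values, so a GDP arises as soon as all values are small and pairwise distinct.
module BaseBlocks (M : ℕ) where

  small<M : ∀ {v} → Small M v → v < M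
  small<M (_ , 2v<M) = ≤-<-trans (m≤m+n _ _) 2v<M

  0<M : ∀ {v} → Small M v → 0 < M
  0<M sv = ≤-<-trans z≤n (small<M sv)

  diff-≥ : ∀ {u v} (p : u < M) (q : v < M) → v ≤ u → diffZ M (fromℕ< p) (fromℕ< q) ≡ u ∸ v
  diff-≥ p q v≤u =
    trans (diffZ-≥ (fromℕ< p) (fromℕ< q) (subst₂ _≤_ (sym (toℕ-fromℕ< q)) (sym (toℕ-fromℕ< p)) v≤u))
          (cong₂ _∸_ (toℕ-fromℕ< p) (toℕ-fromℕ< q))

  diff-< : ∀ {u v} (p : u < M) (q : v < M) → u < v → diffZ M (fromℕ< p) (fromℕ< q) ≡ M + u ∸ v
  diff-< p q u<v =
    trans (diffZ-< (fromℕ< p) (fromℕ< q) (subst₂ _<_ (sym (toℕ-fromℕ< p)) (sym (toℕ-fromℕ< q)) u<v))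
          (cong₂ (λ a b → M + a ∸ b) (toℕ-fromℕ< p) (toℕ-fromℕ< q))

  diff-from-0 : ∀ {v} (o : 0 < M) (p : v < M) → 0 < v → diffZ M (fromℕ< o) (fromℕ< p) ≡ M ∸ v
  diff-from-0 {v} o p 0<v = trans (diff-< o p 0<v) (cong (_∸ v) (+-identityʳ M))

  diff-to-0 : ∀ {v} (o : 0 < M) (p : v < M) → diffZ M (fromℕ< p) (fromℕ< o) ≡ v
  diff-to-0 o p = diff-≥ p o z≤n

  fromℕ<-≢ : ∀ {u v} (p : u < M) (q : v < M) → u ≢ v → fromℕ< p ≢ fromℕ< q
  fromℕ<-≢ p q u≢v e = u≢v (trans (sym (toℕ-fromℕ< p)) (trans (cong toℕ e) (toℕ-fromℕ< q)))

  -- x + y < M, as x + y is either z < M or M − z with z ≥ 1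
  sum<M : ∀ {x y z} → DiffTriple M (x , y , z) → Small M z → x + y < M
  sum<M (inj₁ refl) sz = small<M sz
  sum<M {x} {y} {z} (inj₂ e) (1≤z , _) =
    subst (x + y <_) e (subst (_≤ x + y + z) (+-comm (x + y) 1) (+-monoʳ-≤ (x + y) 1≤z))

  module _ {x y z} (t : DiffTriple M (x , y , z)) (sx : Small M x) (sz : Small M z) (sy : Small M y) where

    private
      o : 0 < M
      o = 0<M sx
      x<M : x < M
      x<M = small<M sx
      s<M : x + y < M
      s<M = sum<M {x} {y} {z} t sz
      x<s : x < x + y
      x<s = subst (_≤ x + y) (+-comm x 1) (+-monoʳ-≤ x (proj₁ sy))

    tripleBlock : Triple M
    tripleBlock = fromℕ< o , fromℕ< x<M , fromℕ< s<M

    tripleBlock-ok : IsTriple tripleBlock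
    tripleBlock-ok =
      fromℕ<-≢ o x<M (<⇒≢ (proj₁ sx)) , fromℕ<-≢ o s<M (<⇒≢ (<-trans (proj₁ sx) x<s)) , fromℕ<-≢ x<M s<M (<⇒≢ x<s)

    tripleBlock-diffs : triDiffs M tripleBlock ≡ M ∸ x ∷ x ∷ M ∸ (x + y) ∷ x + y ∷ M ∸ y ∷ y ∷ []
    tripleBlock-diffs =
      cong₂ _∷_ (diff-from-0 o x<M (proj₁ sx)) (cong₂ _∷_ (diff-to-0 o x<M)
      (cong₂ _∷_ (diff-from-0 o s<M (<-trans (proj₁ sx) x<s)) (cong₂ _∷_ (diff-to-0 o s<M)
      (cong₂ _∷_ (trans (diff-< x<M s<M x<s) M+x∸[x+y])
      (cong₂ _∷_ (trans (diff-≥ s<M x<M (<⇒≤ x<s)) (m+n∸m≡n x y)) refl)))))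
      where
        M+x∸[x+y] : M + x ∸ (x + y) ≡ M ∸ y
        M+x∸[x+y] = trans (cong (_∸ (x + y)) (+-comm M x)) ([m+n]∸[m+o]≡n∸o x M y)

    tripleBlock-copies : ∀ {cs es} → SignedCopies M cs es →
                         SignedCopies M (x ∷ z ∷ y ∷ cs) (triDiffs M tripleBlock ++ es)
    tripleBlock-copies {cs} {es} rest =
      subst (λ l → SignedCopies M (x ∷ z ∷ y ∷ cs) (l ++ es)) (sym tripleBlock-diffs)
            (neg-pos refl refl (middle t (neg-pos refl refl rest)))
      where
        middle : ∀ {cs es} → DiffTriple M (x , y , z) → SignedCopies M cs es →
                 SignedCopies M (z ∷ cs) (M ∸ (x + y) ∷ x + y ∷ es)
        middle (inj₁ e) sc = neg-pos (cong (M ∸_) e) e sc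
        middle (inj₂ e) sc = pos-neg (trans (cong (_∸ (x + y)) (sym e)) (m+n∸m≡n (x + y) z))
                                     (trans (sym (m+n∸n≡m (x + y) z)) (cong (_∸ z) e)) sc

  module _ {p} (sp : Small M p) where

    private
      o : 0 < M
      o = 0<M sp
      p<M : p < M
      p<M = small<M sp

    pairBlock : Pair M
    pairBlock = fromℕ< o , fromℕ< p<M

    pairBlock-ok : IsPair pairBlock
    pairBlock-ok = fromℕ<-≢ o p<M (<⇒≢ (proj₁ sp))

    pairBlock-copies : ∀ {cs es} → SignedCopies M cs es → SignedCopies M (p ∷ cs) (pairDiffs M pairBlock ++ es)
    pairBlock-copies = neg-pos (diff-from-0 o p<M (proj₁ sp)) (diff-to-0 o p<M)

  tripleBlocks : ∀ ts → All (DiffTriple M) ts → All (Small M) (tripleValues ts) → Vec (Triple M) (length ts)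
  tripleBlocks []       []       []                  = V.[]
  tripleBlocks (_ ∷ ts) (t ∷ dts) (sx ∷ sz ∷ sy ∷ ss) = tripleBlock t sx sz sy V.∷ tripleBlocks ts dts ss

  tripleBlocks-ok : ∀ ts dts ss → VA.All IsTriple (tripleBlocks ts dts ss)
  tripleBlocks-ok []       []       []                  = VA.[]
  tripleBlocks-ok (_ ∷ ts) (t ∷ dts) (sx ∷ sz ∷ sy ∷ ss) = tripleBlock-ok t sx sz sy VA.∷ tripleBlocks-ok ts dts ss

  tripleBlocks-copies : ∀ ts dts ss →
    SignedCopies M (tripleValues ts) (concatMap (triDiffs M) (toList (tripleBlocks ts dts ss)))
  tripleBlocks-copies []       []       []                  = none
  tripleBlocks-copies (_ ∷ ts) (t ∷ dts) (sx ∷ sz ∷ sy ∷ ss) = tripleBlock-copies t sx sz sy (tripleBlocks-copies ts dts ss)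

  pairBlocks : ∀ ps → All (Small M) ps → Vec (Pair M) (length ps)
  pairBlocks []       []        = V.[]
  pairBlocks (_ ∷ ps) (sp ∷ ss) = pairBlock sp V.∷ pairBlocks ps ss

  pairBlocks-ok : ∀ ps ss → VA.All IsPair (pairBlocks ps ss)
  pairBlocks-ok []       []        = VA.[]
  pairBlocks-ok (_ ∷ ps) (sp ∷ ss) = pairBlock-ok sp VA.∷ pairBlocks-ok ps ss

  pairBlocks-copies : ∀ ps ss → SignedCopies M ps (concatMap (pairDiffs M) (toList (pairBlocks ps ss)))
  pairBlocks-copies []       []        = none
  pairBlocks-copies (_ ∷ ps) (sp ∷ ss) = pairBlock-copies sp (pairBlocks-copies ps ss)

  gdpFromTriples : ∀ ts ps → All (DiffTriple M) ts → All (Small M) (tripleValues ts ++ ps) →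
                   Unique (tripleValues ts ++ ps) → GDP M (length ts) (length ps)
  gdpFromTriples ts ps dts small distinct = record
    { triples   = tripleBlocks ts dts smallT
    ; pairs     = pairBlocks ps smallP
    ; triplesOk = tripleBlocks-ok ts dts smallT
    ; pairsOk   = pairBlocks-ok ps smallP
    ; packing   = signedCopies-unique (signedCopies-++ (tripleBlocks-copies ts dts smallT) (pairBlocks-copies ps smallP))
                                      distinct small }
    where
      smallT : All (Small M) (tripleValues ts)
      smallT = AllP.++⁻ˡ (tripleValues ts) small
      smallP : All (Small M) ps
      smallP = AllP.++⁻ʳ (tripleValues ts) small

delete : ∀ {A : Set} {x : A} (ys : List A) → x ∈ ys → List A
delete (_ ∷ ys) (here _)  = ys
delete (y ∷ ys) (there m) = y ∷ delete ys m

length-delete : ∀ {A : Set} {x : A} ys (m : x ∈ ys) → length ys ≡ suc (length (delete ys m))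
length-delete (_ ∷ ys) (here _)  = refl
length-delete (_ ∷ ys) (there m) = cong suc (length-delete ys m)

∈-delete : ∀ {A : Set} {x z : A} ys (m : x ∈ ys) → z ∈ ys → z ≢ x → z ∈ delete ys m
∈-delete (_ ∷ ys) (here refl) (here refl) z≢x = ⊥-elim (z≢x refl)
∈-delete (_ ∷ ys) (here refl) (there z∈)  _   = z∈
∈-delete (_ ∷ ys) (there m)   (here refl) _   = here refl
∈-delete (_ ∷ ys) (there m)   (there z∈)  z≢x = there (∈-delete ys m z∈ z≢x)

unique⊆⇒length≤ : ∀ {A : Set} {xs ys : List A} → Unique xs → (∀ {z} → z ∈ xs → z ∈ ys) →
                  length xs ≤ length ys
unique⊂⇒length< : ∀ {A : Set} {xs ys : List A} {y} → Unique xs → (∀ {z} → z ∈ xs → z ∈ ys) →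
                  y ∈ ys → y ∉ xs → length xs < length ys

unique⊆⇒length≤ {xs = []}    _          _     = z≤n
unique⊆⇒length≤ {xs = _ ∷ _} (x≢ ∷ u) xs⊆ys =
  unique⊂⇒length< u (xs⊆ys ∘ there) (xs⊆ys (here refl)) (AllP.All¬⇒¬Any x≢)

-- all of xs lies in ys with y deleted
unique⊂⇒length< {xs = xs} {ys} u xs⊆ys y∈ys y∉xs =
  subst (suc (length xs) ≤_) (sym (length-delete ys y∈ys))
        (s≤s (unique⊆⇒length≤ u (λ z∈ → ∈-delete ys y∈ys (xs⊆ys z∈) (λ { refl → y∉xs z∈ }))))

length-filter+∁ : ∀ {A : Set} {P : A → Set} (P? : Decidable P) xs →
                  length (filter P? xs) + length (filter (∁? P?) xs) ≡ length xs
length-filter+∁ P? []       = refl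
length-filter+∁ P? (x ∷ xs) with P? x
... | yes _ = cong suc (length-filter+∁ P? xs)
... | no  _ = trans (+-suc _ _) (cong suc (length-filter+∁ P? xs))

-- At least H − |C| of the numbers 1, …, H avoid C; any e ≤ H − |C| of them can serve as the
-- differences of the pair blocks.
record FreshValues (C : List ℕ) (H e : ℕ) : Set where
  field
    values   : List ℕ
    count    : length values ≡ e
    distinct : Unique values
    range    : All (λ v → 1 ≤ v × v ≤ H) values
    avoid    : All (_∉ C) values

freshValues : ∀ (C : List ℕ) H e → length C + e ≤ H → FreshValues C H e
freshValues C H e |C|+e≤H = record
  { values   = take e avoiding
  ; count    = trans (length-take e avoiding) (m≤n⇒m⊓n≡m e≤)
  ; distinct = UP.take⁺ e (UP.filter⁺ (∁? (_∈? C)) candidates-unique)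
  ; range    = AllP.take⁺ e (All.tabulate (candidate-range ∘ proj₁ ∘ ∈-avoiding))
  ; avoid    = AllP.take⁺ e (All.tabulate (proj₂ ∘ ∈-avoiding))
  }
  where
    candidates avoiding hitting : List ℕ
    candidates = applyUpTo suc H
    avoiding   = filter (∁? (_∈? C)) candidates
    hitting    = filter (_∈? C) candidates

    ∈-avoiding : ∀ {v} → v ∈ avoiding → v ∈ candidates × v ∉ C
    ∈-avoiding = ∈-filter⁻ (∁? (_∈? C)) {xs = candidates}

    candidates-unique : Unique candidates
    candidates-unique = UP.applyUpTo⁺₁ suc H (λ i<j _ → <⇒≢ (s≤s i<j))

    candidate-range : ∀ {v} → v ∈ candidates → 1 ≤ v × v ≤ H
    candidate-range v∈ with i , i<H , refl ← ∈-applyUpTo⁻ suc v∈ = s≤s z≤n , i<H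

    hitting≤ : length hitting ≤ length C
    hitting≤ = unique⊆⇒length≤ (UP.filter⁺ (_∈? C) candidates-unique) (proj₂ ∘ ∈-filter⁻ (_∈? C) {xs = candidates})

    e≤ : e ≤ length avoiding
    e≤ = +-cancelˡ-≤ (length hitting) e (length avoiding) (begin
      length hitting + e                 ≤⟨ +-monoˡ-≤ e hitting≤ ⟩
      length C + e                       ≤⟨ |C|+e≤H ⟩
      H                                  ≡⟨ sym (length-applyUpTo suc H) ⟩
      length candidates                  ≡⟨ sym (length-filter+∁ (_∈? C) candidates) ⟩
      length hitting + length avoiding   ∎)
      where open ≤-Reasoning

rep : ℕ → ℕ → ℕ
rep M v with v + v <? M
... | yes _ = v
... | no  _ = M ∸ v

rep-small : ∀ {M v} → v + v < M → rep M v ≡ v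
rep-small {M} {v} 2v<M with v + v <? M
... | yes _    = refl
... | no  2v≮M = contradiction 2v<M 2v≮M

-- If M < 2v and v < M, the negative M − v is small: (M − v) + v = M.
neg-small : ∀ {M v} → v < M → M < v + v → (M ∸ v) + (M ∸ v) < M
neg-small {M} {v} v<M M<2v = +-cancelʳ-< (v + v) ((M ∸ v) + (M ∸ v)) M (begin-strict
    (M ∸ v) + (M ∸ v) + (v + v) ≡⟨ interchange (M ∸ v) v ⟩
    ((M ∸ v) + v) + ((M ∸ v) + v) ≡⟨ cong₂ _+_ (m∸n+n≡m (<⇒≤ v<M)) (m∸n+n≡m (<⇒≤ v<M)) ⟩
    M + M                          <⟨ +-monoʳ-< M M<2v ⟩
    M + (v + v)                    ∎)
  where
    open ≤-Reasoning
    interchange : ∀ u v → u + u + (v + v) ≡ (u + v) + (u + v)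
    interchange = solve-∀

Proper : ℕ → ℕ → Set
Proper M v = 1 ≤ v × v < M × v + v ≢ M

rep-Small : ∀ {M v} → Proper M v → Small M (rep M v)
rep-Small {M} {v} (1≤v , v<M , 2v≢M) with v + v <? M
... | yes 2v<M = 1≤v , 2v<M
... | no  2v≮M = m<n⇒0<n∸m v<M , neg-small v<M (≤∧≢⇒< (≮⇒≥ 2v≮M) (2v≢M ∘ sym))

rep-distinct : ∀ {M v v'} → Proper M v → Proper M v' → v ≢ v' → v + v' ≢ M → rep M v ≢ rep M v'
rep-distinct {M} {v} {v'} (_ , v<M , _) (_ , v'<M , _) v≢v' v+v'≢M e with v + v <? M | v' + v' <? M
... | yes _ | yes _ = v≢v' e
... | yes _ | no  _ = v+v'≢M (trans (cong (_+ v') e) (m∸n+n≡m (<⇒≤ v'<M)))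
... | no  _ | yes _ = v+v'≢M (trans (cong (v +_) (sym e)) (m+[n∸m]≡n (<⇒≤ v<M)))
... | no  _ | no  _ = v≢v' (∸-cancelˡ-≡ (<⇒≤ v<M) (<⇒≤ v'<M) e)

diffTriple-rep : ∀ {M x y w} → x + y ≡ w → w < M → DiffTriple M (x , y , rep M w)
diffTriple-rep {M} {x} {y} {w} x+y≡w w<M with w + w <? M
... | yes _ = inj₁ x+y≡w
... | no  _ = inj₂ (trans (cong (_+ (M ∸ w)) x+y≡w) (m+[n∸m]≡n (<⇒≤ w<M)))

length-tripleValues : ∀ ts → length (tripleValues ts) ≡ 3 * length ts
length-tripleValues []       = refl
length-tripleValues (_ ∷ ts) = trans (cong (3 +_) (length-tripleValues ts)) (sym (*-suc 3 (length ts)))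

allPairs-with : ∀ {A : Set} {P : A → Set} {R : A → A → Set} {xs} →
                All P xs → AllPairs R xs → AllPairs (λ x y → P x × P y × R x y) xs
allPairs-with []         []         = []
allPairs-with (px ∷ pxs) (rx ∷ rxs) = All.zipWith (λ (py , r) → px , py , r) (pxs , rx) ∷ allPairs-with pxs rxs

Compatible : ℕ × ℕ → ℕ × ℕ → Set
Compatible (a , b) (a' , b') = (b ∸ a ≢ b' ∸ a') × (a ≢ a') × (a ≢ b') × (b ≢ a') × (b ≢ b')

SkolemPair : ℕ → ℕ → ℕ → ℕ × ℕ → Set
SkolemPair n B hole (a , b) = 1 ≤ a × a < b × b ∸ a ≤ n × b ≤ B × a ≢ hole × b ≢ hole

-- n pairwise compatible Skolem pairs.  For B = 2n they are the position pairs of the symbols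
-- 1, …, n of a Skolem sequence of order n, for B = 2n + 1 and hole = 2n of a hooked one.
record SkolemSystem (n B hole : ℕ) : Set where
  field
    pairs      : List (ℕ × ℕ)
    size       : length pairs ≡ n
    pair-ok    : All (SkolemPair n B hole) pairs
    compatible : AllPairs Compatible pairs

-- The values d = b − a, n + b, n + a of a Skolem pair; they satisfy d + (n + a) = n + b,
-- and over a whole Skolem sequence they are exactly 1, …, 3n.
skolemValues : ℕ → ℕ × ℕ → List ℕ
skolemValues n (a , b) = b ∸ a ∷ n + b ∷ n + a ∷ []

skolemTriple : ℕ → ℕ → ℕ × ℕ → ℕ × ℕ × ℕ
skolemTriple M n (a , b) = b ∸ a , n + a , rep M (n + b)

-- A Skolem-type system of order n gives a GDP(M, 3ⁿ 2^e₂) through the difference triples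
-- (b − a, n + a, ±(n + b)), provided the values all satisfy a property P which keeps them
-- nonzero, below M and pairwise non-complementary modulo M, and M leaves room for e₂ further
-- small values.
module FromSkolem {n B hole : ℕ} (M e₂ : ℕ) (P : ℕ → Set) (sk : SkolemSystem n B hole)
  (values-P           : ∀ {a b} → SkolemPair n B hole (a , b) → P (b ∸ a) × P (n + b) × P (n + a))
  (P-range            : ∀ {v} → P v → 1 ≤ v × v < M)
  (P-noncomplementary : ∀ {v v'} → P v → P v' → v + v' ≢ M)
  (firsts-small       : ∀ {a b} → SkolemPair n B hole (a , b) → (b ∸ a) + (b ∸ a) < M × (n + a) + (n + a) < M)
  (room               : (3 * n + e₂) + (3 * n + e₂) < M) where

  open SkolemSystem sk

  P-proper : ∀ {v} → P v → Proper M v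
  P-proper p = proj₁ (P-range p) , proj₂ (P-range p) , P-noncomplementary p p

  d<n+a : ∀ {a b} → SkolemPair n B hole (a , b) → b ∸ a < n + a
  d<n+a {a} (1≤a , _ , d≤n , _) = ≤-<-trans d≤n (subst (_< n + a) (+-identityʳ n) (+-monoʳ-< n 1≤a))

  1≤b : ∀ {a b} → SkolemPair n B hole (a , b) → 1 ≤ b
  1≤b (1≤a , a<b , _) = ≤-trans 1≤a (<⇒≤ a<b)

  values-unique : ∀ {x} → SkolemPair n B hole x → Unique (skolemValues n x)
  values-unique ok@(_ , a<b , _) =
    (<⇒≢ (<-trans (d<n+a ok) n+a<n+b) ∷ <⇒≢ (d<n+a ok) ∷ []) ∷ (<⇒≢ n+a<n+b ∘ sym ∷ []) ∷ [] ∷ []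
    where n+a<n+b = +-monoʳ-< n a<b

  d≢n+c : ∀ {d c} → d ≤ n → 1 ≤ c → d ≢ n + c
  d≢n+c d≤n 1≤c = <⇒≢ (≤-<-trans d≤n (subst (_< n + _) (+-identityʳ n) (+-monoʳ-< n 1≤c)))

  values-disjoint : ∀ {x y} → SkolemPair n B hole x → SkolemPair n B hole y → Compatible x y →
                    Disjoint (skolemValues n x) (skolemValues n y)
  values-disjoint ok@(1≤a , _ , d≤n , _) ok'@(1≤a' , _ , d'≤n , _) (d≢ , a≢a' , a≢b' , b≢a' , b≢b') (v∈ , v∈') =
    clash v∈ v∈'
    where
      clash : ∀ {v} → v ∈ skolemValues n _ → v ∈ skolemValues n _ → ⊥
      clash (here refl)                 (here e)                 = d≢ e
      clash (here refl)                 (there (here e))         = d≢n+c d≤n (1≤b ok') e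
      clash (here refl)                 (there (there (here e))) = d≢n+c d≤n 1≤a' e
      clash (there (here refl))         (here e)                 = d≢n+c d'≤n (1≤b ok) (sym e)
      clash (there (here refl))         (there (here e))         = b≢b' (+-cancelˡ-≡ n _ _ e)
      clash (there (here refl))         (there (there (here e))) = b≢a' (+-cancelˡ-≡ n _ _ e)
      clash (there (there (here refl))) (here e)                 = d≢n+c d'≤n 1≤a (sym e)
      clash (there (there (here refl))) (there (here e))         = a≢b' (+-cancelˡ-≡ n _ _ e)
      clash (there (there (here refl))) (there (there (here e))) = a≢a' (+-cancelˡ-≡ n _ _ e)

  values : List ℕ
  values = concatMap (skolemValues n) pairs

  all-values-unique : Unique values
  all-values-unique = UP.concat⁺ (AllP.map⁺ (All.map values-unique pair-ok))
    (AllPairsP.map⁺ (AllPairs.map (λ (ok , ok' , c) {v} → values-disjoint ok ok' c {v}) (allPairs-with pair-ok compatible)))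

  all-values-P : All P values
  all-values-P = AllP.concat⁺ (AllP.map⁺ (All.map (λ ok → let (p₁ , p₂ , p₃) = values-P ok in p₁ ∷ p₂ ∷ p₃ ∷ []) pair-ok))

  triples : List (ℕ × ℕ × ℕ)
  triples = map (skolemTriple M n) pairs

  triples-diff : All (DiffTriple M) triples
  triples-diff = AllP.map⁺ (All.map diff pair-ok)
    where
      diff : ∀ {x} → SkolemPair n B hole x → DiffTriple M (skolemTriple M n x)
      diff {a , b} ok@(_ , a<b , _) = diffTriple-rep {M} {b ∸ a} {n + a} d+[n+a]≡n+b (proj₂ (P-range (proj₁ (proj₂ (values-P ok)))))
        where
          d+[n+a]≡n+b : (b ∸ a) + (n + a) ≡ n + b
          d+[n+a]≡n+b = trans (+-comm (b ∸ a) (n + a)) (trans (+-assoc n a (b ∸ a)) (cong (n +_) (m+[n∸m]≡n (<⇒≤ a<b))))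

  -- the first two values of each triple are already small, the third is reduced by rep
  tripleValues≡reps : ∀ qs → All (SkolemPair n B hole) qs →
                      tripleValues (map (skolemTriple M n) qs) ≡ map (rep M) (concatMap (skolemValues n) qs)
  tripleValues≡reps []               []         = refl
  tripleValues≡reps ((a , b) ∷ qs) (ok ∷ oks) =
    cong₂ _∷_ (sym (rep-small (proj₁ (firsts-small ok)))) (cong (rep M (n + b) ∷_)
      (cong₂ _∷_ (sym (rep-small (proj₂ (firsts-small ok)))) (tripleValues≡reps qs oks)))

  reps : List ℕ
  reps = tripleValues triples

  reps-unique : Unique reps
  reps-unique = subst Unique (sym (tripleValues≡reps pairs pair-ok))
    (AllPairsP.map⁺ (AllPairs.map (λ (p , p' , v≢v') → rep-distinct (P-proper p) (P-proper p') v≢v' (P-noncomplementary p p'))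
                                  (allPairs-with all-values-P all-values-unique)))

  reps-small : All (Small M) reps
  reps-small = subst (All (Small M)) (sym (tripleValues≡reps pairs pair-ok)) (AllP.map⁺ (All.map (rep-Small ∘ P-proper) all-values-P))

  length-reps : length reps ≡ 3 * n
  length-reps = trans (length-tripleValues triples) (cong (3 *_) (trans (length-map _ pairs) size))

  module Singles = FreshValues (freshValues reps (3 * n + e₂) e₂ (≤-reflexive (cong (_+ e₂) length-reps)))

  singles-small : All (Small M) Singles.values
  singles-small = All.map (λ (1≤p , p≤) → 1≤p , ≤-<-trans (+-mono-≤ p≤ p≤) room) Singles.range

  gdp : GDP M n e₂
  gdp = subst₂ (GDP M) (trans (length-map _ pairs) size) Singles.count
    (BaseBlocks.gdpFromTriples M triples Singles.values triples-diff (AllP.++⁺ reps-small singles-small)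
      (UP.++⁺ reps-unique Singles.distinct (λ (v∈reps , v∈singles) → All.lookup Singles.avoid v∈singles v∈reps)))

%2-+-double : ∀ x k → (x + (k + k)) % 2 ≡ x % 2
%2-+-double x k = trans (cong (λ z → (x + z) % 2) (k+k≡k*2 k)) ([m+kn]%n≡m%n x k 2)
  where
    k+k≡k*2 : ∀ k → k + k ≡ k * 2
    k+k≡k*2 = solve-∀

double-injective : ∀ {x y} → x + x ≡ y + y → x ≡ y
double-injective {x} {y} e with <-cmp x y
... | tri< x<y _ _ = ⊥-elim (<-irrefl e (+-mono-< x<y x<y))
... | tri≈ _ x≡y _ = x≡y
... | tri> _ _ y<x = ⊥-elim (<-irrefl (sym e) (+-mono-< y<x y<x))

parity-of : ∀ {d i h e} → e ≤ 1 → d + i + i ≡ h + h + e → d % 2 ≡ e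
parity-of {d} {i} {h} {e} e≤1 eq = begin
  d % 2               ≡⟨ sym (%2-+-double d i) ⟩
  (d + (i + i)) % 2   ≡⟨ cong (_% 2) (trans (sym (+-assoc d i i)) (trans eq (+-comm (h + h) e))) ⟩
  (e + (h + h)) % 2   ≡⟨ %2-+-double e h ⟩
  e % 2               ≡⟨ m<n⇒m%n≡m (s≤s e≤1) ⟩
  e                   ∎
  where open ≡-Reasoning

same-difference : ∀ {d i j h h' e e'} → e ≤ 1 → e' ≤ 1 →
                  d + i + i ≡ h + h + e → d + j + j ≡ h' + h' + e' → e ≡ e' × h + j ≡ h' + i
same-difference {d} {i} {j} {h} {h'} {e} {e'} e≤1 e'≤1 eq eq' = e≡e' , double-injective (+-cancelʳ-≡ e _ _ (begin
    (h + j) + (h + j) + e     ≡⟨ regroup h j e ⟩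
    (h + h + e) + (j + j)     ≡⟨ cong (_+ (j + j)) (sym eq) ⟩
    (d + i + i) + (j + j)     ≡⟨ swap d i j ⟩
    (d + j + j) + (i + i)     ≡⟨ cong (_+ (i + i)) eq' ⟩
    (h' + h' + e') + (i + i)  ≡⟨ cong (λ z → (h' + h' + z) + (i + i)) (sym e≡e') ⟩
    (h' + h' + e) + (i + i)   ≡⟨ sym (regroup h' i e) ⟩
    (h' + i) + (h' + i) + e   ∎))
  where
    open ≡-Reasoning
    e≡e' : e ≡ e'
    e≡e' = trans (sym (parity-of {d} {i} {h} e≤1 eq)) (parity-of {d} {j} {h'} e'≤1 eq')
    regroup : ∀ h j e → (h + j) + (h + j) + e ≡ (h + h + e) + (j + j)
    regroup = solve-∀
    swap : ∀ d i j → (d + i + i) + (j + j) ≡ (d + j + j) + (i + i)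
    swap = solve-∀

-- The nested family of L pairs (p + i , q + L − i), i < L.  Its differences q + L − p − 2i
-- run down in steps of two; Skolem sequences are assembled from such families.
nested : ℕ → ℕ → ℕ → List (ℕ × ℕ)
nested p q zero    = []
nested p q (suc L) = (p , q + suc L) ∷ nested (suc p) q L

length-nested : ∀ p q L → length (nested p q L) ≡ L
length-nested p q zero    = refl
length-nested p q (suc L) = cong suc (length-nested (suc p) q L)

record Member (p q L : ℕ) (x : ℕ × ℕ) : Set where
  field
    index   : ℕ
    index<L : index < L
    left≡   : proj₁ x ≡ p + index
    right≡  : proj₂ x + index ≡ q + L

∈-nested : ∀ {p q L x} → x ∈ nested p q L → Member p q L x
∈-nested {p} {q} {suc L} (here refl) = record
  { index = 0 ; index<L = s≤s z≤n ; left≡ = sym (+-identityʳ p) ; right≡ = +-identityʳ _ }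
∈-nested {p} {q} {suc L} {a , b} (there x∈) = record
  { index   = suc i
  ; index<L = s≤s i<L
  ; left≡   = trans a≡ (sym (+-suc p i))
  ; right≡  = trans (+-suc b i) (trans (cong suc b≡) (sym (+-suc q L))) }
  where open Member (∈-nested {suc p} {q} {L} x∈) renaming (index to i; index<L to i<L; left≡ to a≡; right≡ to b≡)

InInterval : ℕ → ℕ → ℕ → Set
InInterval lo len v = lo ≤ v × v < lo + len

Apart : ℕ → ℕ → ℕ → ℕ → Set
Apart lo len lo' len' = lo + len ≤ lo' ⊎ lo' + len' ≤ lo

apart-≢ : ∀ {lo len lo' len' v v'} → Apart lo len lo' len' → InInterval lo len v → InInterval lo' len' v' → v ≢ v'
apart-≢ (inj₁ le) (_ , v<) (lo'≤ , _) refl = <-irrefl refl (<-≤-trans v< (≤-trans le lo'≤))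
apart-≢ (inj₂ le) (lo≤ , _) (_ , v<) refl = <-irrefl refl (<-≤-trans v< (≤-trans le lo≤))

module MemberFacts {p q L : ℕ} (left<right : p + L ≤ q + 1) {a b : ℕ} (m : Member p q L (a , b)) where
  open Member m renaming (index to i; index<L to i<L; left≡ to a≡; right≡ to b≡)

  a<b : a < b
  a<b = +-cancelʳ-≤ i (suc a) b (begin
    suc a + i          ≡⟨ cong (λ x → suc x + i) a≡ ⟩
    suc (p + i) + i    ≡⟨ sym (+-suc (p + i) i) ⟩
    (p + i) + suc i    ≤⟨ +-monoʳ-≤ (p + i) i<L ⟩
    (p + i) + L        ≡⟨ shift p i L ⟩
    (p + L) + i        ≤⟨ +-monoˡ-≤ i left<right ⟩
    (q + 1) + i        ≡⟨ +-assoc q 1 i ⟩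
    q + suc i          ≤⟨ +-monoʳ-≤ q i<L ⟩
    q + L              ≡⟨ sym b≡ ⟩
    b + i              ∎)
    where
      open ≤-Reasoning
      shift : ∀ p i L → (p + i) + L ≡ (p + L) + i
      shift = solve-∀

  left-in : InInterval p L a
  left-in = subst (p ≤_) (sym a≡) (m≤m+n p i) , subst (_< p + L) (sym a≡) (+-monoʳ-< p i<L)

  q<b : q < b
  q<b = +-cancelʳ-< i q b (subst (q + i <_) (sym b≡) (+-monoʳ-< q i<L))

  b≤q+L : b ≤ q + L
  b≤q+L = subst (b ≤_) b≡ (m≤m+n b i)

  right-in : InInterval (q + 1) L b
  right-in = subst (_≤ b) (+-comm 1 q) q<b , subst (b <_) (sym (trans (+-assoc q 1 L) (+-suc q L))) (s≤s b≤q+L)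

  difference : (b ∸ a) + i + i + p ≡ q + L
  difference = begin
    (b ∸ a) + i + i + p        ≡⟨ regroup (b ∸ a) i p ⟩
    ((b ∸ a) + (p + i)) + i    ≡⟨ cong (λ x → ((b ∸ a) + x) + i) (sym a≡) ⟩
    ((b ∸ a) + a) + i          ≡⟨ cong (_+ i) (m∸n+n≡m (<⇒≤ a<b)) ⟩
    b + i                      ≡⟨ b≡ ⟩
    q + L                      ∎
    where
      open ≡-Reasoning
      regroup : ∀ d i p → d + i + i + p ≡ (d + (p + i)) + i
      regroup = solve-∀

-- Distinct members of one nested family are compatible: their differences differ by a
-- positive even number and their positions lie in two disjoint decreasing/increasing runs.
nested-compatible : ∀ p q L → p + L ≤ q + 1 → AllPairs Compatible (nested p q L)
nested-compatible p q zero    _          = []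
nested-compatible p q (suc L) left<right = All.tabulate first-compatible ∷ nested-compatible (suc p) q L left<right'
  where
    left<right' : suc p + L ≤ q + 1
    left<right' = subst (_≤ q + 1) (+-suc p L) left<right
    p≤q : p ≤ q
    p≤q = +-cancelʳ-≤ 1 p q (≤-trans (+-monoʳ-≤ p (s≤s z≤n)) left<right)
    top : q + L < q + suc L
    top = +-monoʳ-< q (n<1+n L)
    first-compatible : ∀ {y} → y ∈ nested (suc p) q L → Compatible (p , q + suc L) y
    first-compatible {a' , b'} y∈ = d≢ , p≢a' , p≢b' , top≢a' , top≢b'
      where
        m : Member (suc p) q L (a' , b')
        m = ∈-nested {suc p} {q} {L} y∈
        open Member m renaming (index to j)
        open MemberFacts left<right' m
        open ≤-Reasoning
        d≢ : (q + suc L) ∸ p ≢ b' ∸ a'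
        d≢ e = <-irrefl refl (begin-strict
          q + suc L                                   ≡⟨ sym (m∸n+n≡m (≤-trans p≤q (m≤m+n q (suc L)))) ⟩
          ((q + suc L) ∸ p) + p                       ≤⟨ +-monoˡ-≤ p (m≤m+n _ (j + j)) ⟩
          (((q + suc L) ∸ p) + (j + j)) + p           <⟨ +-monoʳ-< _ (n<1+n p) ⟩
          (((q + suc L) ∸ p) + (j + j)) + suc p       ≡⟨ cong (λ x → (x + (j + j)) + suc p) e ⟩
          ((b' ∸ a') + (j + j)) + suc p               ≡⟨ cong (_+ suc p) (sym (+-assoc (b' ∸ a') j j)) ⟩
          (b' ∸ a') + j + j + suc p                   ≡⟨ difference ⟩
          q + L                                       <⟨ top ⟩
          q + suc L                                   ∎)
        p≢a' : p ≢ a'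
        p≢a' e = <-irrefl e (<-≤-trans (n<1+n p) (subst (suc p ≤_) (sym left≡) (m≤m+n (suc p) j)))
        p≢b' : p ≢ b'
        p≢b' e = <-irrefl e (≤-<-trans p≤q q<b)
        top≢a' : q + suc L ≢ a'
        top≢a' e = <-irrefl (sym e) (<-trans a<b (≤-<-trans b≤q+L top))
        top≢b' : q + suc L ≢ b'
        top≢b' e = <-irrefl (sym e) (≤-<-trans b≤q+L top)

record NestedOK (n B hole p q L h e : ℕ) : Set where
  field
    1≤p            : 1 ≤ p
    left<right     : p + L ≤ q + 1
    difference≤n   : q + L ≤ n + p
    right≤B        : q + L ≤ B
    left-avoids    : Apart p L hole 1
    right-avoids   : Apart (q + 1) L hole 1
    top-difference : h + h + (e + p) ≡ q + L
    parity≤1       : e ≤ 1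

record NestedApart (p q L h e p' q' L' h' e' : ℕ) : Set where
  field
    left-left   : Apart p L p' L'
    left-right  : Apart p L (q' + 1) L'
    right-left  : Apart (q + 1) L p' L'
    right-right : Apart (q + 1) L (q' + 1) L'
    differences : e ≢ e' ⊎ h + L' ≤ h' ⊎ h' + L ≤ h

module _ {n B hole p q L h e : ℕ} (ok : NestedOK n B hole p q L h e) where
  open NestedOK ok

  member-difference : ∀ {a b} (m : Member p q L (a , b)) → let i = Member.index m in (b ∸ a) + i + i ≡ h + h + e
  member-difference {a} {b} m = +-cancelʳ-≡ p _ _
    (trans (MemberFacts.difference left<right m) (trans (sym top-difference) (sym (+-assoc (h + h) e p))))

  nested-pair-ok : ∀ {x} → x ∈ nested p q L → SkolemPair n B hole x
  nested-pair-ok {a , b} x∈ =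
    ≤-trans 1≤p (proj₁ left-in) , a<b , d≤n , ≤-trans b≤q+L right≤B ,
    (λ a≡hole → apart-≢ left-avoids left-in (hole-in) a≡hole) ,
    (λ b≡hole → apart-≢ right-avoids right-in (hole-in) b≡hole)
    where
      m : Member p q L (a , b)
      m = ∈-nested x∈
      open Member m renaming (index to i)
      open MemberFacts left<right m
      hole-in : InInterval hole 1 hole
      hole-in = ≤-refl , subst (hole <_) (+-comm 1 hole) ≤-refl
      d≤n : b ∸ a ≤ n
      d≤n = +-cancelʳ-≤ p (b ∸ a) n (begin
        (b ∸ a) + p              ≤⟨ +-monoˡ-≤ p (≤-trans (m≤m+n (b ∸ a) i) (m≤m+n _ i)) ⟩
        (b ∸ a) + i + i + p      ≡⟨ difference ⟩
        q + L                    ≤⟨ difference≤n ⟩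
        n + p                    ∎)
        where open ≤-Reasoning

nested-cross : ∀ {n B hole p q L h e p' q' L' h' e'} →
  NestedOK n B hole p q L h e → NestedOK n B hole p' q' L' h' e' → NestedApart p q L h e p' q' L' h' e' →
  ∀ {x y} → x ∈ nested p q L → y ∈ nested p' q' L' → Compatible x y
nested-cross {p = p} {q} {L} {h} {p' = p'} {q'} {L'} {h'} {e'} ok ok' apart {a , b} {a' , b'} x∈ y∈ =
  d≢d' , apart-≢ left-left X.left-in Y.left-in , apart-≢ left-right X.left-in Y.right-in ,
  apart-≢ right-left X.right-in Y.left-in , apart-≢ right-right X.right-in Y.right-in
  where
    open NestedApart apart
    mx : Member p q L (a , b)
    mx = ∈-nested x∈
    my : Member p' q' L' (a' , b')
    my = ∈-nested y∈
    module X = MemberFacts (NestedOK.left<right ok) mx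
    module Y = MemberFacts (NestedOK.left<right ok') my
    i j : ℕ
    i = Member.index mx
    j = Member.index my
    d≢d' : b ∸ a ≢ b' ∸ a'
    d≢d' d≡d' with same-difference {b ∸ a} {i} {j} {h} {h'} (NestedOK.parity≤1 ok) (NestedOK.parity≤1 ok') (member-difference ok mx)
                                   (subst (λ d → d + j + j ≡ h' + h' + e') (sym d≡d') (member-difference ok' my))
    ... | e≡e' , h+j≡h'+i with differences
    ...   | inj₁ e≢e'        = e≢e' e≡e'
    ...   | inj₂ (inj₁ h+L'≤h') = <-irrefl h+j≡h'+i (<-≤-trans (+-monoʳ-< h (Member.index<L my)) (≤-trans h+L'≤h' (m≤m+n h' i)))
    ...   | inj₂ (inj₂ h'+L≤h)  = <-irrefl (sym h+j≡h'+i) (<-≤-trans (+-monoʳ-< h' (Member.index<L mx)) (≤-trans h'+L≤h (m≤m+n h j)))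

-- The Skolem sequences needed below form infinite families indexed by t;
-- each is a list of nested families whose parameters are affine functions a·t + b of t.
-- All side conditions are then checked coefficientwise by a boolean test, which is sound
-- for every t since t ↦ a·t + b is monotone in the coefficients.
Affine : Set
Affine = ℕ × ℕ

⟦_⟧ : Affine → ℕ → ℕ
⟦ a , b ⟧ t = a * t + b

infixl 8 _⊕_
_⊕_ : Affine → Affine → Affine
(a , b) ⊕ (c , d) = a + c , b + d

one : Affine
one = 0 , 1

⟦⊕⟧ : ∀ x y t → ⟦ x ⊕ y ⟧ t ≡ ⟦ x ⟧ t + ⟦ y ⟧ t
⟦⊕⟧ (a , b) (c , d) t = distribute a b c d t
  where
    distribute : ∀ a b c d t → (a + c) * t + (b + d) ≡ (a * t + b) + (c * t + d)
    distribute = solve-∀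

infix 7 _≤ᴬ_ _≡ᴬ_
_≤ᴬ_ : Affine → Affine → Bool
(a , b) ≤ᴬ (c , d) = (a ≤ᵇ c) ∧ (b ≤ᵇ d)

_≡ᴬ_ : Affine → Affine → Bool
(a , b) ≡ᴬ (c , d) = (a ≡ᵇ c) ∧ (b ≡ᵇ d)

T-∧⁻ : ∀ {x y} → T (x ∧ y) → T x × T y
T-∧⁻ = Equivalence.to T-∧

T-∨⁻ : ∀ {x y} → T (x ∨ y) → T x ⊎ T y
T-∨⁻ = Equivalence.to T-∨

≤ᴬ-sound : ∀ x y t → T (x ≤ᴬ y) → ⟦ x ⟧ t ≤ ⟦ y ⟧ t
≤ᴬ-sound (a , b) (c , d) t h with a≤c , b≤d ← T-∧⁻ {a ≤ᵇ c} h =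
  +-mono-≤ (*-monoˡ-≤ t (≤ᵇ⇒≤ a c a≤c)) (≤ᵇ⇒≤ b d b≤d)

≡ᴬ-sound : ∀ x y t → T (x ≡ᴬ y) → ⟦ x ⟧ t ≡ ⟦ y ⟧ t
≡ᴬ-sound (a , b) (c , d) t h with a≡c , b≡d ← T-∧⁻ {a ≡ᵇ c} h =
  cong₂ (λ u v → u * t + v) (≡ᵇ⇒≡ a c a≡c) (≡ᵇ⇒≡ b d b≡d)

apartᴬ : Affine → Affine → Affine → Affine → Bool
apartᴬ lo len lo' len' = (lo ⊕ len ≤ᴬ lo') ∨ (lo' ⊕ len' ≤ᴬ lo)

record Family : Set where
  constructor family
  field
    left right size : Affine

-- Half and parity of the largest difference q + L − p, computed coefficientwise; the check
-- below confirms that they really describe q + L − p.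
topDifference : Family → Affine
topDifference (family (p₁ , p₀) (q₁ , q₀) (L₁ , L₀)) = q₁ + L₁ ∸ p₁ , q₀ + L₀ ∸ p₀

half : Family → Affine
half F = ⌊ proj₁ (topDifference F) /2⌋ , ⌊ proj₂ (topDifference F) /2⌋

parity : Family → ℕ
parity F = proj₂ (topDifference F) % 2

familyCheck : Affine → Affine → Affine → Family → Bool
familyCheck n B hole F@(family p q L) =
  one ≤ᴬ p ∧ p ⊕ L ≤ᴬ q ⊕ one ∧ q ⊕ L ≤ᴬ n ⊕ p ∧ q ⊕ L ≤ᴬ B ∧
  apartᴬ p L hole one ∧ apartᴬ (q ⊕ one) L hole one ∧
  half F ⊕ half F ⊕ ((0 , parity F) ⊕ p) ≡ᴬ q ⊕ L ∧ (parity F ≤ᵇ 1)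

apartCheck : Family → Family → Bool
apartCheck F@(family p q L) G@(family p' q' L') =
  apartᴬ p L p' L' ∧ apartᴬ p L (q' ⊕ one) L' ∧ apartᴬ (q ⊕ one) L p' L' ∧ apartᴬ (q ⊕ one) L (q' ⊕ one) L' ∧
  (not (parity F ≡ᵇ parity G) ∨ half F ⊕ L' ≤ᴬ half G ∨ half G ⊕ L ≤ᴬ half F)

allPairsᵇ : ∀ {A : Set} → (A → A → Bool) → List A → Bool
allPairsᵇ f []       = true
allPairsᵇ f (x ∷ xs) = all (f x) xs ∧ allPairsᵇ f xs

allPairsᵇ-sound : ∀ {A : Set} {f : A → A → Bool} xs → T (allPairsᵇ f xs) → AllPairs (λ x y → T (f x y)) xs
allPairsᵇ-sound []       _ = []
allPairsᵇ-sound {f = f} (x ∷ xs) h with hx , hxs ← T-∧⁻ {all (f x) xs} h = AllP.all⁺ (f x) xs hx ∷ allPairsᵇ-sound xs hxs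

totalSize : List Family → Affine
totalSize []       = 0 , 0
totalSize (F ∷ Fs) = Family.size F ⊕ totalSize Fs

certificateCheck : Affine → Affine → Affine → List Family → Bool
certificateCheck n B hole Fs = all (familyCheck n B hole) Fs ∧ allPairsᵇ apartCheck Fs ∧ totalSize Fs ≡ᴬ n

module Certificate (n B hole : Affine) (t : ℕ) where

  pairsOf : Family → List (ℕ × ℕ)
  pairsOf (family p q L) = nested (⟦ p ⟧ t) (⟦ q ⟧ t) (⟦ L ⟧ t)

  ⊕≡ : ∀ x y → ⟦ x ⊕ y ⟧ t ≡ ⟦ x ⟧ t + ⟦ y ⟧ t
  ⊕≡ x y = ⟦⊕⟧ x y t

  apart-sound : ∀ lo len lo' len' → T (apartᴬ lo len lo' len') →
                Apart (⟦ lo ⟧ t) (⟦ len ⟧ t) (⟦ lo' ⟧ t) (⟦ len' ⟧ t)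
  apart-sound lo len lo' len' h with T-∨⁻ {lo ⊕ len ≤ᴬ lo'} h
  ... | inj₁ h₁ = inj₁ (subst (_≤ ⟦ lo' ⟧ t) (⊕≡ lo len) (≤ᴬ-sound (lo ⊕ len) lo' t h₁))
  ... | inj₂ h₂ = inj₂ (subst (_≤ ⟦ lo ⟧ t) (⊕≡ lo' len') (≤ᴬ-sound (lo' ⊕ len') lo t h₂))

  apart-sound⁺¹ : ∀ q L lo' len' → T (apartᴬ (q ⊕ one) L lo' len') →
                  Apart (⟦ q ⟧ t + 1) (⟦ L ⟧ t) (⟦ lo' ⟧ t) (⟦ len' ⟧ t)
  apart-sound⁺¹ q L lo' len' h = subst (λ z → Apart z (⟦ L ⟧ t) (⟦ lo' ⟧ t) (⟦ len' ⟧ t)) (⊕≡ q one) (apart-sound (q ⊕ one) L lo' len' h)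

  apart-sym : ∀ {lo len lo' len'} → Apart lo len lo' len' → Apart lo' len' lo len
  apart-sym (inj₁ le) = inj₂ le
  apart-sym (inj₂ le) = inj₁ le

  family-sound : ∀ F → T (familyCheck n B hole F) →
    let family p q L = F in
    NestedOK (⟦ n ⟧ t) (⟦ B ⟧ t) (⟦ hole ⟧ t) (⟦ p ⟧ t) (⟦ q ⟧ t) (⟦ L ⟧ t) (⟦ half F ⟧ t) (parity F)
  family-sound F@(family p q L) h
    with c₁ , h₁ ← T-∧⁻ {one ≤ᴬ p} h
    with c₂ , h₂ ← T-∧⁻ {p ⊕ L ≤ᴬ q ⊕ one} h₁
    with c₃ , h₃ ← T-∧⁻ {q ⊕ L ≤ᴬ n ⊕ p} h₂
    with c₄ , h₄ ← T-∧⁻ {q ⊕ L ≤ᴬ B} h₃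
    with c₅ , h₅ ← T-∧⁻ {apartᴬ p L hole one} h₄
    with c₆ , h₆ ← T-∧⁻ {apartᴬ (q ⊕ one) L hole one} h₅
    with c₇ , c₈ ← T-∧⁻ {half F ⊕ half F ⊕ ((0 , parity F) ⊕ p) ≡ᴬ q ⊕ L} h₆ = record
    { 1≤p            = ≤ᴬ-sound one p t c₁
    ; left<right     = subst₂ _≤_ (⊕≡ p L) (⊕≡ q one) (≤ᴬ-sound (p ⊕ L) (q ⊕ one) t c₂)
    ; difference≤n   = subst₂ _≤_ (⊕≡ q L) (⊕≡ n p) (≤ᴬ-sound (q ⊕ L) (n ⊕ p) t c₃)
    ; right≤B        = subst (_≤ ⟦ B ⟧ t) (⊕≡ q L) (≤ᴬ-sound (q ⊕ L) B t c₄)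
    ; left-avoids    = apart-sound p L hole one c₅
    ; right-avoids   = apart-sound⁺¹ q L hole one c₆
    ; top-difference = begin
        ⟦ half F ⟧ t + ⟦ half F ⟧ t + (parity F + ⟦ p ⟧ t)  ≡⟨ sym (cong₂ _+_ (⊕≡ (half F) (half F)) (⊕≡ (0 , parity F) p)) ⟩
        ⟦ half F ⊕ half F ⟧ t + ⟦ (0 , parity F) ⊕ p ⟧ t    ≡⟨ sym (⊕≡ (half F ⊕ half F) ((0 , parity F) ⊕ p)) ⟩
        ⟦ half F ⊕ half F ⊕ ((0 , parity F) ⊕ p) ⟧ t        ≡⟨ ≡ᴬ-sound (half F ⊕ half F ⊕ ((0 , parity F) ⊕ p)) (q ⊕ L) t c₇ ⟩
        ⟦ q ⊕ L ⟧ t                                         ≡⟨ ⊕≡ q L ⟩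
        ⟦ q ⟧ t + ⟦ L ⟧ t                                   ∎
    ; parity≤1       = ≤ᵇ⇒≤ (parity F) 1 c₈ }
    where open ≡-Reasoning

  apartness-sound : ∀ F G → T (apartCheck F G) →
    let family p q L = F ; family p' q' L' = G in
    NestedApart (⟦ p ⟧ t) (⟦ q ⟧ t) (⟦ L ⟧ t) (⟦ half F ⟧ t) (parity F) (⟦ p' ⟧ t) (⟦ q' ⟧ t) (⟦ L' ⟧ t) (⟦ half G ⟧ t) (parity G)
  apartness-sound F@(family p q L) G@(family p' q' L') h
    with c₁ , h₁ ← T-∧⁻ {apartᴬ p L p' L'} h
    with c₂ , h₂ ← T-∧⁻ {apartᴬ p L (q' ⊕ one) L'} h₁
    with c₃ , h₃ ← T-∧⁻ {apartᴬ (q ⊕ one) L p' L'} h₂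
    with c₄ , c₅ ← T-∧⁻ {apartᴬ (q ⊕ one) L (q' ⊕ one) L'} h₃ = record
    { left-left   = apart-sound p L p' L' c₁
    ; left-right  = apart-sym (apart-sound⁺¹ q' L' p L (apartᴬ-sym p L (q' ⊕ one) L' c₂))
    ; right-left  = apart-sound⁺¹ q L p' L' c₃
    ; right-right = subst (λ z → Apart (⟦ q ⟧ t + 1) (⟦ L ⟧ t) z (⟦ L' ⟧ t)) (⊕≡ q' one) (apart-sound⁺¹ q L (q' ⊕ one) L' c₄)
    ; differences = differences-sound c₅ }
    where
      apartᴬ-sym : ∀ lo len lo' len' → T (apartᴬ lo len lo' len') → T (apartᴬ lo' len' lo len)
      apartᴬ-sym lo len lo' len' h with T-∨⁻ {lo ⊕ len ≤ᴬ lo'} h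
      ... | inj₁ h₁ = Equivalence.from T-∨ (inj₂ h₁)
      ... | inj₂ h₂ = Equivalence.from T-∨ (inj₁ h₂)
      differences-sound : T (not (parity F ≡ᵇ parity G) ∨ half F ⊕ L' ≤ᴬ half G ∨ half G ⊕ L ≤ᴬ half F) →
        parity F ≢ parity G ⊎ ⟦ half F ⟧ t + ⟦ L' ⟧ t ≤ ⟦ half G ⟧ t ⊎ ⟦ half G ⟧ t + ⟦ L ⟧ t ≤ ⟦ half F ⟧ t
      differences-sound h with T-∨⁻ {not (parity F ≡ᵇ parity G)} h
      ... | inj₁ ≢ᵇ = inj₁ (λ e → subst (T ∘ not) (≡⇒≡ᵇ-true e) ≢ᵇ)
        where
          ≡⇒≡ᵇ-true : ∀ {x y} → x ≡ y → (x ≡ᵇ y) ≡ true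
          ≡⇒≡ᵇ-true {x} refl = Equivalence.to T-≡ (≡⇒≡ᵇ x x refl)
      ... | inj₂ h' with T-∨⁻ {half F ⊕ L' ≤ᴬ half G} h'
      ...   | inj₁ le = inj₂ (inj₁ (subst (_≤ ⟦ half G ⟧ t) (⊕≡ (half F) L') (≤ᴬ-sound (half F ⊕ L') (half G) t le)))
      ...   | inj₂ le = inj₂ (inj₂ (subst (_≤ ⟦ half F ⟧ t) (⊕≡ (half G) L) (≤ᴬ-sound (half G ⊕ L) (half F) t le)))

  length-pairs : ∀ Fs → length (concatMap pairsOf Fs) ≡ ⟦ totalSize Fs ⟧ t
  length-pairs []                   = refl
  length-pairs (F@(family p q L) ∷ Fs) = trans (length-++ (pairsOf F))
    (trans (cong₂ _+_ (length-nested (⟦ p ⟧ t) (⟦ q ⟧ t) (⟦ L ⟧ t)) (length-pairs Fs)) (sym (⊕≡ L (totalSize Fs))))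

  sound : ∀ Fs → T (certificateCheck n B hole Fs) → SkolemSystem (⟦ n ⟧ t) (⟦ B ⟧ t) (⟦ hole ⟧ t)
  sound Fs h
    with hF , h₁ ← T-∧⁻ {all (familyCheck n B hole) Fs} h
    with hA , hN ← T-∧⁻ {allPairsᵇ apartCheck Fs} h₁ = record
    { pairs      = concatMap pairsOf Fs
    ; size       = trans (length-pairs Fs) (≡ᴬ-sound (totalSize Fs) n t hN)
    ; pair-ok    = AllP.concat⁺ (AllP.map⁺ (All.map (λ {F} c → All.tabulate (nested-pair-ok (family-sound F c))) checked))
    ; compatible = AllPairsP.concat⁺ (AllP.map⁺ (All.map (λ {F} → within {F}) checked))
                                     (AllPairsP.map⁺ (AllPairs.map (λ {F} {G} → across {F} {G}) (allPairs-with checked (allPairsᵇ-sound Fs hA)))) }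
    where
      checked = AllP.all⁺ (familyCheck n B hole) Fs hF
      within : ∀ {F} → T (familyCheck n B hole F) → AllPairs Compatible (pairsOf F)
      within {F@(family _ _ _)} c = nested-compatible _ _ _ (NestedOK.left<right (family-sound F c))
      across : ∀ {F G} → T (familyCheck n B hole F) × T (familyCheck n B hole G) × T (apartCheck F G) →
               All (λ x → All (Compatible x) (pairsOf G)) (pairsOf F)
      across {F@(family _ _ _)} {G@(family _ _ _)} (cF , cG , cFG) = All.tabulate λ x∈ → All.tabulate λ y∈ →
        nested-cross (family-sound F cF) (family-sound G cG) (apartness-sound F G cFG) x∈ y∈

-- Skolem sequences (positions 1, …, 2n) and hooked Skolem sequences (positions 1, …, 2n + 1
-- except 2n) of order n.
Skolem Hooked : ℕ → Set
Skolem n = SkolemSystem n (n + n) (suc (n + n))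
Hooked n = SkolemSystem n (suc (n + n)) (n + n)

double : ∀ a b t → (a + a) * t + (b + b) ≡ (a * t + b) + (a * t + b)
double = solve-∀

double+1 : ∀ a b t → (a + a) * t + suc (b + b) ≡ suc (⟦ a , b ⟧ t + ⟦ a , b ⟧ t)
double+1 a b t = trans (+-suc _ _) (cong suc (double a b t))

skolemCertificate : ∀ a b Fs → T (certificateCheck (a , b) (a + a , b + b) (a + a , suc (b + b)) Fs) →
                    ∀ t → Skolem (⟦ a , b ⟧ t)
skolemCertificate a b Fs ok t =
  subst₂ (SkolemSystem (⟦ a , b ⟧ t)) (double a b t) (double+1 a b t) (Certificate.sound _ _ _ t Fs ok)

hookedCertificate : ∀ a b Fs → T (certificateCheck (a , b) (a + a , suc (b + b)) (a + a , b + b) Fs) →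
                    ∀ t → Hooked (⟦ a , b ⟧ t)
hookedCertificate a b Fs ok t =
  subst₂ (SkolemSystem (⟦ a , b ⟧ t)) (double+1 a b t) (double a b t) (Certificate.sound _ _ _ t Fs ok)

single : ℕ → ℕ → Family
single a b = family (0 , a) (0 , b ∸ 1) (0 , 1)

skolem-4t+8 skolem-4t+9 hooked-4t+6 hooked-4t+7 : List Family
skolem-4t+8 =
  family (4 , 8) (6 , 12) (2 , 4) ∷ family (0 , 1) (3 , 5) (1 , 1) ∷ family (1 , 4) (2 , 5) (1 , 0) ∷
  family (1 , 2) (1 , 2) (0 , 1) ∷ family (2 , 4) (4 , 6) (0 , 1) ∷ family (2 , 5) (6 , 11) (0 , 1) ∷ []
skolem-4t+9 =
  family (4 , 10) (6 , 14) (2 , 4) ∷ family (0 , 1) (3 , 6) (1 , 2) ∷ family (1 , 5) (2 , 6) (1 , 0) ∷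
  family (1 , 3) (1 , 3) (0 , 1) ∷ family (2 , 5) (6 , 13) (0 , 1) ∷ family (2 , 6) (4 , 8) (0 , 1) ∷ []
hooked-4t+6 =
  family (0 , 1) (2 , 3) (2 , 2) ∷ family (2 , 3) (6 , 8) (0 , 1) ∷ family (6 , 10) (8 , 12) (0 , 1) ∷
  family (4 , 6) (7 , 10) (1 , 1) ∷ family (5 , 7) (5 , 7) (0 , 1) ∷ family (5 , 9) (6 , 10) (1 , 0) ∷ []
hooked-4t+7 =
  family (0 , 1) (2 , 4) (2 , 3) ∷ family (2 , 4) (6 , 10) (0 , 1) ∷ family (6 , 12) (8 , 14) (0 , 1) ∷
  family (4 , 8) (7 , 12) (1 , 1) ∷ family (5 , 9) (5 , 9) (0 , 1) ∷ family (5 , 11) (6 , 12) (1 , 0) ∷ []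

skolem-1 skolem-4 skolem-5 hooked-2 hooked-3 : List Family
skolem-1 = single 1 2 ∷ []
skolem-4 = single 1 5 ∷ single 3 6 ∷ single 2 4 ∷ single 7 8 ∷ []
skolem-5 = single 1 6 ∷ single 3 7 ∷ single 5 8 ∷ single 2 4 ∷ single 9 10 ∷ []
hooked-2 = single 3 5 ∷ single 1 2 ∷ []
hooked-3 = single 1 4 ∷ single 5 7 ∷ single 2 3 ∷ []

SkolemOrHooked : ℕ → Set
SkolemOrHooked n = Skolem n ⊎ (Hooked n × (n % 4 ≡ 2 ⊎ n % 4 ≡ 3))

regroup : ∀ r c t → 4 * t + (r + c * 4) ≡ r + (c + t) * 4
regroup = solve-∀

skolemOrHooked-residue : ∀ r k → r < 4 → SkolemOrHooked (r + k * 4)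
skolemOrHooked-residue 0 0             _ = inj₁ (skolemCertificate 0 0 [] tt 0)
skolemOrHooked-residue 0 1             _ = inj₁ (skolemCertificate 0 4 skolem-4 tt 0)
skolemOrHooked-residue 0 (suc (suc t)) _ = inj₁ (subst Skolem (regroup 0 2 t) (skolemCertificate 4 8 skolem-4t+8 tt t))
skolemOrHooked-residue 1 0             _ = inj₁ (skolemCertificate 0 1 skolem-1 tt 0)
skolemOrHooked-residue 1 1             _ = inj₁ (skolemCertificate 0 5 skolem-5 tt 0)
skolemOrHooked-residue 1 (suc (suc t)) _ = inj₁ (subst Skolem (regroup 1 2 t) (skolemCertificate 4 9 skolem-4t+9 tt t))
skolemOrHooked-residue 2 0             _ = inj₂ (hookedCertificate 0 2 hooked-2 tt 0 , inj₁ refl)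
skolemOrHooked-residue 2 (suc t)       _ =
  inj₂ (subst Hooked (regroup 2 1 t) (hookedCertificate 4 6 hooked-4t+6 tt t) , inj₁ ([m+kn]%n≡m%n 2 (suc t) 4))
skolemOrHooked-residue 3 0             _ = inj₂ (hookedCertificate 0 3 hooked-3 tt 0 , inj₂ refl)
skolemOrHooked-residue 3 (suc t)       _ =
  inj₂ (subst Hooked (regroup 3 1 t) (hookedCertificate 4 7 hooked-4t+7 tt t) , inj₂ ([m+kn]%n≡m%n 3 (suc t) 4))
skolemOrHooked-residue (suc (suc (suc (suc _)))) _ (s≤s (s≤s (s≤s (s≤s ()))))

skolemOrHooked : ∀ n → SkolemOrHooked n
skolemOrHooked n = subst SkolemOrHooked (sym (m≡m%n+[m/n]*n n 4)) (skolemOrHooked-residue (n % 4) (n / 4) (m%n<n n 4))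

-- For e₁ = n and M ≥ 6n + 2e₂ + 1 the Skolem triples have values in 1, …, 3n
-- (Skolem case) or in 1, …, 3n + 1 without 3n (hooked case); no two of them sum to M,
-- except 3n + 1 with itself when M = 6n + 2.
module Existence (n e₂ M : ℕ) (bound : 6 * n + 2 * e₂ + 1 ≤ M) where

  top : ℕ
  top = n + (n + n)

  6n≡top+top : 6 * n ≡ top + top
  6n≡top+top = six n
    where
      six : ∀ n → 6 * n ≡ (n + (n + n)) + (n + (n + n))
      six = solve-∀

  room : (3 * n + e₂) + (3 * n + e₂) < M
  room = subst (_≤ M) (rearrange n e₂) bound
    where
      rearrange : ∀ n e → 6 * n + 2 * e + 1 ≡ suc ((3 * n + e) + (3 * n + e))
      rearrange = solve-∀

  top+top<M : top + top < M
  top+top<M = begin-strict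
    top + top           ≡⟨ sym 6n≡top+top ⟩
    6 * n               ≤⟨ m≤m+n (6 * n) (2 * e₂) ⟩
    6 * n + 2 * e₂      <⟨ subst (6 * n + 2 * e₂ <_) (+-comm 1 (6 * n + 2 * e₂)) ≤-refl ⟩
    6 * n + 2 * e₂ + 1  ≤⟨ bound ⟩
    M                   ∎
    where open ≤-Reasoning

  below-half : ∀ {v} → v ≤ top → v + v < M
  below-half v≤ = ≤-<-trans (+-mono-≤ v≤ v≤) top+top<M

  InSkolemRange : ℕ → Set
  InSkolemRange v = 1 ≤ v × v ≤ top

  skolemGDP : Skolem n → GDP M n e₂
  skolemGDP sk = FromSkolem.gdp M e₂ InSkolemRange sk values-in-range in-range⇒range noncomplementary firsts-small room
    where
      values-in-range : ∀ {a b} → SkolemPair n (n + n) (suc (n + n)) (a , b) →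
                        InSkolemRange (b ∸ a) × InSkolemRange (n + b) × InSkolemRange (n + a)
      values-in-range {a} {b} (1≤a , a<b , d≤n , b≤2n , _) =
        (m<n⇒0<n∸m a<b , ≤-trans d≤n (m≤m+n n (n + n))) ,
        (≤-trans (≤-trans 1≤a (<⇒≤ a<b)) (m≤n+m b n) , +-monoʳ-≤ n b≤2n) ,
        (≤-trans 1≤a (m≤n+m a n) , +-monoʳ-≤ n (≤-trans (<⇒≤ a<b) b≤2n))
      in-range⇒range : ∀ {v} → InSkolemRange v → 1 ≤ v × v < M
      in-range⇒range (1≤v , v≤) = 1≤v , ≤-<-trans (≤-trans v≤ (m≤m+n top top)) top+top<M
      noncomplementary : ∀ {v v'} → InSkolemRange v → InSkolemRange v' → v + v' ≢ M
      noncomplementary (_ , v≤) (_ , v'≤) e = <-irrefl e (≤-<-trans (+-mono-≤ v≤ v'≤) top+top<M)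
      firsts-small : ∀ {a b} → SkolemPair n (n + n) (suc (n + n)) (a , b) → (b ∸ a) + (b ∸ a) < M × (n + a) + (n + a) < M
      firsts-small ok with (_ , d≤) , _ , (_ , n+a≤) ← values-in-range ok = below-half d≤ , below-half n+a≤

  InHookedRange : ℕ → Set
  InHookedRange v = 1 ≤ v × v ≤ suc top × v ≢ top

  hooked-cases : ∀ {v} → v ≤ suc top → v ≢ top → v < top ⊎ v ≡ suc top
  hooked-cases v≤ v≢ with m≤n⇒m<n∨m≡n v≤
  ... | inj₂ v≡ = inj₂ v≡
  ... | inj₁ v<  with m≤n⇒m<n∨m≡n (≤-pred v<)
  ...   | inj₁ v<top = inj₁ v<top
  ...   | inj₂ v≡top = ⊥-elim (v≢ v≡top)

  hookedGDP : 1 ≤ n → M ≢ suc (suc (top + top)) → Hooked n → GDP M n e₂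
  hookedGDP 1≤n M≢ sk = FromSkolem.gdp M e₂ InHookedRange sk values-in-range in-range⇒range noncomplementary firsts-small room
    where
      n+2n≡top+1 : n + suc (n + n) ≡ suc top
      n+2n≡top+1 = +-suc n (n + n)
      values-in-range : ∀ {a b} → SkolemPair n (suc (n + n)) (n + n) (a , b) →
                        InHookedRange (b ∸ a) × InHookedRange (n + b) × InHookedRange (n + a)
      values-in-range {a} {b} (1≤a , a<b , d≤n , b≤ , a≢2n , b≢2n) =
        (m<n⇒0<n∸m a<b , ≤-trans d≤n (≤-trans (m≤m+n n (n + n)) (n≤1+n top)) , d≢top) ,
        (≤-trans (≤-trans 1≤a (<⇒≤ a<b)) (m≤n+m b n) , subst (n + b ≤_) n+2n≡top+1 (+-monoʳ-≤ n b≤) ,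
           b≢2n ∘ +-cancelˡ-≡ n b (n + n)) ,
        (≤-trans 1≤a (m≤n+m a n) , subst (n + a ≤_) n+2n≡top+1 (+-monoʳ-≤ n (≤-trans (<⇒≤ a<b) b≤)) ,
           a≢2n ∘ +-cancelˡ-≡ n a (n + n))
        where
          d≢top : b ∸ a ≢ top
          d≢top e = <-irrefl e (≤-<-trans d≤n (subst (_< top) (+-identityʳ n) (+-monoʳ-< n (≤-trans 1≤n (m≤m+n n n)))))
      noncomplementary : ∀ {v v'} → InHookedRange v → InHookedRange v' → v + v' ≢ M
      noncomplementary (_ , v≤ , v≢) (_ , v'≤ , v'≢) e with hooked-cases v≤ v≢ | hooked-cases v'≤ v'≢
      ... | inj₁ v<top  | _            = <-irrefl e (<-≤-trans (+-mono-<-≤ v<top v'≤) (subst (_≤ M) (sym (+-suc top top)) top+top<M))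
      ... | inj₂ refl   | inj₁ v'<top  = <-irrefl e (<-≤-trans (+-monoʳ-< (suc top) v'<top) top+top<M)
      ... | inj₂ refl   | inj₂ refl    = M≢ (trans (sym e) (cong suc (+-suc top top)))
      in-range⇒range : ∀ {v} → InHookedRange v → 1 ≤ v × v < M
      in-range⇒range (1≤v , v≤ , _) = 1≤v , ≤-<-trans v≤ (≤-<-trans (+-monoˡ-≤ top 1≤top) top+top<M)
        where
          1≤top : 1 ≤ top
          1≤top = ≤-trans 1≤n (m≤m+n n (n + n))
      firsts-small : ∀ {a b} → SkolemPair n (suc (n + n)) (n + n) (a , b) → (b ∸ a) + (b ∸ a) < M × (n + a) + (n + a) < M
      firsts-small {a} {b} (_ , a<b , d≤n , b≤ , a≢2n , _) =
        below-half (≤-trans d≤n (m≤m+n n (n + n))) , below-half (<⇒≤ (+-monoʳ-< n a<2n))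
        where
          a<2n : a < n + n
          a<2n with m≤n⇒m<n∨m≡n (≤-pred (≤-trans a<b b≤))
          ... | inj₁ a<  = a<
          ... | inj₂ a≡  = ⊥-elim (a≢2n a≡)

no-room : ∀ a e → a + 2 * e + 1 ≤ a + 2 → e ≡ 0
no-room a zero    _ = refl
no-room a (suc k) h with subst (_≤ 2) (rearrange k) (+-cancelˡ-≤ a _ 2 (subst (_≤ a + 2) (+-assoc a (2 * suc k) 1) h))
  where
    rearrange : ∀ k → 2 * suc k + 1 ≡ 3 + 2 * k
    rearrange = solve-∀
... | s≤s (s≤s ())

residue-positive : ∀ {n} → n % 4 ≡ 2 ⊎ n % 4 ≡ 3 → 1 ≤ n
residue-positive {zero}  (inj₁ ())
residue-positive {zero}  (inj₂ ())
residue-positive {suc _} _ = s≤s z≤n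

existence : ∀ e₁ e₂ M → 6 * e₁ + 2 * e₂ + 1 ≤ M → ¬ Exceptional M e₁ e₂ → GDP M e₁ e₂
existence e₁ e₂ M bound regular with skolemOrHooked e₁
... | inj₁ sk             = Existence.skolemGDP e₁ e₂ M bound sk
... | inj₂ (hk , residue) = Existence.hookedGDP e₁ e₂ M bound (residue-positive residue) M≢6e₁+2 hk
  where
    open Existence e₁ e₂ M bound using (top; 6n≡top+top)
    -- if M = 6e₁ + 2 then the bound forces e₂ = 0, the exceptional case
    M≢6e₁+2 : M ≢ suc (suc (top + top))
    M≢6e₁+2 M≡ = regular (residue , M≡6e₁+2 , no-room (6 * e₁) e₂ (subst (6 * e₁ + 2 * e₂ + 1 ≤_) M≡6e₁+2 bound))
      where
        M≡6e₁+2 : M ≡ 6 * e₁ + 2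
        M≡6e₁+2 = trans M≡ (trans (+-comm 2 (top + top)) (cong (_+ 2) (sym 6n≡top+top)))

≡suc⇒≢0 : ∀ {v s} → v ≡ suc s → v ≢ 0
≡suc⇒≢0 v≡ v≡0 = 0≢1+n (trans (sym v≡0) v≡)

Odd : ℕ → Set
Odd v = v % 2 ≡ 1

Odd? : Decidable Odd
Odd? v = v % 2 ≟ 1

parity-cases : ∀ v → v % 2 ≡ 0 ⊎ v % 2 ≡ 1
parity-cases v with v % 2 | m%n<n v 2
... | 0           | _ = inj₁ refl
... | 1           | _ = inj₂ refl
... | suc (suc _) | s≤s (s≤s ())

oddCount : List ℕ → ℕ
oddCount xs = sum (map (_% 2) xs)

oddCount-++ : ∀ xs ys → oddCount (xs ++ ys) ≡ oddCount xs + oddCount ys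
oddCount-++ xs ys = trans (cong sum (map-++ (_% 2) xs ys)) (sum-++ (map (_% 2) xs) (map (_% 2) ys))

oddCount≡length : ∀ xs → oddCount xs ≡ length (filter Odd? xs)
oddCount≡length []       = refl
oddCount≡length (x ∷ xs) with parity-cases x
... | inj₁ even = trans (cong (_+ oddCount xs) even)
                        (trans (oddCount≡length xs) (sym (cong length (filter-reject Odd? {x} {xs} (λ odd → ≡suc⇒≢0 odd even)))))
... | inj₂ odd  = trans (cong (_+ oddCount xs) odd)
                        (trans (cong suc (oddCount≡length xs)) (sym (cong length (filter-accept Odd? {x} {xs} odd))))

diffZ-parity : ∀ m (a b : Fin (m + m)) → diffZ (m + m) a b % 2 ≡ (toℕ a % 2 + toℕ b % 2) % 2
diffZ-parity m a b = trans (parity-sum (toℕ b ≤? toℕ a)) (%-distribˡ-+ (toℕ a) (toℕ b) 2)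
  where
    α β : ℕ
    α = toℕ a
    β = toℕ b
    -- d + 2β = α + β + 2k for the difference d, so d and α + β have the same parity
    parity-sum : Dec (β ≤ α) → diffZ (m + m) a b % 2 ≡ (α + β) % 2
    parity-sum (yes β≤α) = begin
      diffZ (m + m) a b % 2     ≡⟨ cong (_% 2) (diffZ-≥ a b β≤α) ⟩
      (α ∸ β) % 2               ≡⟨ sym (%2-+-double (α ∸ β) β) ⟩
      ((α ∸ β) + (β + β)) % 2   ≡⟨ cong (_% 2) (trans (sym (+-assoc (α ∸ β) β β)) (cong (_+ β) (m∸n+n≡m β≤α))) ⟩
      (α + β) % 2               ∎
      where open ≡-Reasoning
    parity-sum (no β≰α) = begin
      diffZ (m + m) a b % 2                 ≡⟨ cong (_% 2) (diffZ-< a b (≰⇒> β≰α)) ⟩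
      d % 2                                 ≡⟨ sym (%2-+-double d β) ⟩
      (d + (β + β)) % 2                     ≡⟨ cong (_% 2) d+2β ⟩
      ((α + β) + (m + m)) % 2               ≡⟨ %2-+-double (α + β) m ⟩
      (α + β) % 2                           ∎
      where
        open ≡-Reasoning
        d : ℕ
        d = m + m + α ∸ β
        β≤ : β ≤ m + m + α
        β≤ = ≤-trans (<⇒≤ (toℕ<n b)) (m≤m+n (m + m) α)
        rearrange : ∀ m α β → m + m + α + β ≡ (α + β) + (m + m)
        rearrange = solve-∀
        d+2β : d + (β + β) ≡ (α + β) + (m + m)
        d+2β = trans (sym (+-assoc d β β)) (trans (cong (_+ β) (m∸n+n≡m β≤)) (rearrange m α β))

oddDifferences : ℕ → ℕ → ℕ → ℕ
oddDifferences x y z =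
  (x + y) % 2 + ((y + x) % 2 + ((x + z) % 2 + ((z + x) % 2 + ((y + z) % 2 + ((z + y) % 2 + 0)))))

oddDifferences-0or4 : ∀ {x y z} → x ≡ 0 ⊎ x ≡ 1 → y ≡ 0 ⊎ y ≡ 1 → z ≡ 0 ⊎ z ≡ 1 →
                      ∃ λ k → oddDifferences x y z ≡ 4 * k
oddDifferences-0or4 (inj₁ refl) (inj₁ refl) (inj₁ refl) = 0 , refl
oddDifferences-0or4 (inj₁ refl) (inj₁ refl) (inj₂ refl) = 1 , refl
oddDifferences-0or4 (inj₁ refl) (inj₂ refl) (inj₁ refl) = 1 , refl
oddDifferences-0or4 (inj₁ refl) (inj₂ refl) (inj₂ refl) = 1 , refl
oddDifferences-0or4 (inj₂ refl) (inj₁ refl) (inj₁ refl) = 1 , refl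
oddDifferences-0or4 (inj₂ refl) (inj₁ refl) (inj₂ refl) = 1 , refl
oddDifferences-0or4 (inj₂ refl) (inj₂ refl) (inj₁ refl) = 1 , refl
oddDifferences-0or4 (inj₂ refl) (inj₂ refl) (inj₂ refl) = 0 , refl

block-oddCount : ∀ m (t : Triple (m + m)) → ∃ λ k → oddCount (triDiffs (m + m) t) ≡ 4 * k
block-oddCount m (a , b , c) =
  let k , eq = oddDifferences-0or4 (parity-cases (toℕ a)) (parity-cases (toℕ b)) (parity-cases (toℕ c)) in
  k , trans as-parities eq
  where
    pd : ∀ u v → diffZ (m + m) u v % 2 ≡ (toℕ u % 2 + toℕ v % 2) % 2
    pd = diffZ-parity m
    as-parities : oddCount (triDiffs (m + m) (a , b , c)) ≡ oddDifferences (toℕ a % 2) (toℕ b % 2) (toℕ c % 2)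
    as-parities = cong₂ _+_ (pd a b) (cong₂ _+_ (pd b a) (cong₂ _+_ (pd a c) (cong₂ _+_ (pd c a)
                    (cong₂ _+_ (pd b c) (cong₂ _+_ (pd c b) refl)))))

NonzeroResidue : ℕ → ℕ → Set
NonzeroResidue M v = 1 ≤ v × v < M

diffZ-nonzero : ∀ M (a b : Fin M) → a ≢ b → NonzeroResidue M (diffZ M a b)
diffZ-nonzero M a b a≢b with toℕ b ≤? toℕ a
... | yes β≤α = subst (NonzeroResidue M) (sym (diffZ-≥ a b β≤α))
                  (m<n⇒0<n∸m β<α , ≤-<-trans (m∸n≤m (toℕ a) (toℕ b)) (toℕ<n a))
  where
    β<α : toℕ b < toℕ a
    β<α = ≤∧≢⇒< β≤α (a≢b ∘ sym ∘ toℕ-injective)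
... | no β≰α = subst (NonzeroResidue M) (sym (diffZ-< a b α<β))
                 (m<n⇒0<n∸m (<-≤-trans (toℕ<n b) (m≤m+n M (toℕ a))) ,
                  +-cancelʳ-< (toℕ b) _ M (subst (_< M + toℕ b) (sym (m∸n+n≡m β≤)) (+-monoʳ-< M α<β)))
  where
    α<β = ≰⇒> β≰α
    β≤ : toℕ b ≤ M + toℕ a
    β≤ = ≤-trans (<⇒≤ (toℕ<n b)) (m≤m+n M (toℕ a))

block-nonzero : ∀ M (t : Triple M) → IsTriple t → All (NonzeroResidue M) (triDiffs M t)
block-nonzero M (a , b , c) (a≢b , a≢c , b≢c) =
  nz a b a≢b ∷ nz b a (a≢b ∘ sym) ∷ nz a c a≢c ∷ nz c a (a≢c ∘ sym) ∷ nz b c b≢c ∷ nz c b (b≢c ∘ sym) ∷ []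
  where nz = diffZ-nonzero M

differences : ∀ {M e} → Vec (Triple M) e → List ℕ
differences {M} T = concatMap (triDiffs M) (toList T)

length-differences : ∀ {M e} (T : Vec (Triple M) e) → length (differences T) ≡ 6 * e
length-differences V.[]            = refl
length-differences {e = suc e} (t V.∷ T) = trans (cong (6 +_) (length-differences T)) (sym (*-suc 6 e))

differences-nonzero : ∀ {M e} (T : Vec (Triple M) e) → VA.All IsTriple T → All (NonzeroResidue M) (differences T)
differences-nonzero V.[]      VA.[]        = []
differences-nonzero (t V.∷ T) (ok VA.∷ oks) = AllP.++⁺ (block-nonzero _ t ok) (differences-nonzero T oks)

differences-oddCount : ∀ m {e} (T : Vec (Triple (m + m)) e) → ∃ λ K → oddCount (differences T) ≡ 4 * K
differences-oddCount m V.[]      = 0 , refl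
differences-oddCount m (t V.∷ T) =
  let k , eq = block-oddCount m t ; K , eq' = differences-oddCount m T in
  k + K , trans (oddCount-++ (triDiffs (m + m) t) (differences T)) (trans (cong₂ _+_ eq eq') (sym (*-distribˡ-+ 4 k K)))

odds-below : ∀ m → length (filter Odd? (downFrom (m + m))) ≡ m
odds-below zero    = refl
odds-below (suc m) rewrite +-suc m m =
  trans (cong length (filter-accept Odd? {suc (m + m)} {m + m ∷ downFrom (m + m)} (%2-+-double 1 m)))
        (cong suc (trans (cong length (filter-reject Odd? {m + m} {downFrom (m + m)} (λ odd → ≡suc⇒≢0 odd (%2-+-double 0 m))))
                         (odds-below m)))

evens-below : ∀ m → length (filter (∁? Odd?) (downFrom (m + m))) ≡ m
evens-below m = +-cancelˡ-≡ m _ m (begin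
  m + evens                                    ≡⟨ cong (_+ evens) (sym (odds-below m)) ⟩
  length (filter Odd? below) + evens           ≡⟨ length-filter+∁ Odd? below ⟩
  length below                                 ≡⟨ length-downFrom (m + m) ⟩
  m + m                                        ∎)
  where
    open ≡-Reasoning
    below : List ℕ
    below = downFrom (m + m)
    evens : ℕ
    evens = length (filter (∁? Odd?) below)

odd-differences-bounds : ∀ e (T : Vec (Triple (suc (3 * e) + suc (3 * e))) e) → VA.All IsTriple T → Unique (differences T) →
                         ∃ λ K → 3 * e ≤ 4 * K × 4 * K ≤ suc (3 * e)
odd-differences-bounds e T oks distinct = K , lower , subst (_≤ suc (3 * e)) odd≡4K odd≤
  where
    m K odd even : ℕ
    m = suc (3 * e)
    K = proj₁ (differences-oddCount m T)
    L : List ℕ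
    L = differences T
    nonzero : All (NonzeroResidue (m + m)) L
    nonzero = differences-nonzero T oks
    odd  = length (filter Odd? L)
    even = length (filter (∁? Odd?) L)
    odd≡4K : odd ≡ 4 * K
    odd≡4K = trans (sym (oddCount≡length L)) (proj₂ (differences-oddCount m T))
    within : ∀ {P : ℕ → Set} (P? : Decidable P) {z} → z ∈ filter P? L → z ∈ filter P? (downFrom (m + m))
    within P? z∈ with z∈L , pz ← ∈-filter⁻ P? {xs = L} z∈ =
      ∈-filter⁺ P? {xs = downFrom (m + m)} (∈-downFrom⁺ (proj₂ (All.lookup nonzero z∈L))) pz
    odd≤ : odd ≤ m
    odd≤ = subst (odd ≤_) (odds-below m) (unique⊆⇒length≤ (UP.filter⁺ Odd? distinct) (within Odd?))
    -- the even residue 0 is not a difference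
    even< : even < m
    even< = subst (even <_) (evens-below m)
      (unique⊂⇒length< (UP.filter⁺ (∁? Odd?) distinct) (within (∁? Odd?))
        (∈-filter⁺ (∁? Odd?) {xs = downFrom (m + m)} (∈-downFrom⁺ (s≤s z≤n)) (λ ())) 0∉)
      where
        0∉ : 0 ∉ filter (∁? Odd?) L
        0∉ 0∈ = <-irrefl refl (proj₁ (All.lookup nonzero (proj₁ (∈-filter⁻ (∁? Odd?) {xs = L} 0∈))))
    lower : 3 * e ≤ 4 * K
    lower = subst (3 * e ≤_) odd≡4K (+-cancelʳ-≤ (3 * e) (3 * e) odd (begin
      3 * e + 3 * e    ≡⟨ six e ⟩
      6 * e            ≡⟨ sym (trans (length-filter+∁ Odd? L) (length-differences T)) ⟩
      odd + even       ≤⟨ +-monoʳ-≤ odd (≤-pred even<) ⟩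
      odd + 3 * e      ∎))
      where
        open ≤-Reasoning
        six : ∀ e → 3 * e + 3 * e ≡ 6 * e
        six = solve-∀

thrice%4 : ∀ e {r} → e % 4 ≡ r → (3 * e) % 4 ≡ (3 * r) % 4
thrice%4 e e≡r = trans (%-distribˡ-* 3 e 4) (cong (λ r → (3 * r) % 4) e≡r)

thrice+1%4 : ∀ e {r} → e % 4 ≡ r → suc (3 * e) % 4 ≡ (1 + (3 * r) % 4) % 4
thrice+1%4 e e≡r = trans (%-distribˡ-+ 1 (3 * e) 4) (cong (λ s → (1 + s) % 4) (thrice%4 e e≡r))

threefold-residues : ∀ e → e % 4 ≡ 2 ⊎ e % 4 ≡ 3 → (3 * e) % 4 ≢ 0 × suc (3 * e) % 4 ≢ 0
threefold-residues e (inj₁ e≡2) = ≡suc⇒≢0 (thrice%4 e e≡2) , ≡suc⇒≢0 (thrice+1%4 e e≡2)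
threefold-residues e (inj₂ e≡3) = ≡suc⇒≢0 (thrice%4 e e≡3) , ≡suc⇒≢0 (thrice+1%4 e e≡3)

multiple-of-4 : ∀ K {v} → 4 * K ≡ v → v % 4 ≡ 0
multiple-of-4 K refl = trans (cong (_% 4) (*-comm 4 K)) (m*n%n≡0 K 4)

-- With no pair blocks, the packing condition concerns the differences of the triples alone.
triples-distinct : ∀ {M e} (g : GDP M e 0) → Unique (differences (GDP.triples g))
triples-distinct g with GDP.pairs g | GDP.packing g
... | V.[] | packing = subst Unique (++-identityʳ _) packing

odd-differences-multiple : ∀ e → GDP (6 * e + 2) e 0 → ∃ λ K → 4 * K ≡ 3 * e ⊎ 4 * K ≡ suc (3 * e)
odd-differences-multiple e gdp = exact (subst (λ M → GDP M e 0) (six+2 e) gdp)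
  where
    six+2 : ∀ e → 6 * e + 2 ≡ suc (3 * e) + suc (3 * e)
    six+2 = solve-∀
    exact : GDP (suc (3 * e) + suc (3 * e)) e 0 → ∃ λ K → 4 * K ≡ 3 * e ⊎ 4 * K ≡ suc (3 * e)
    exact g with K , lower , upper ← odd-differences-bounds e (GDP.triples g) (GDP.triplesOk g) (triples-distinct g) =
      K , Sum.map (λ below → ≤-antisym (≤-pred below) lower) (λ eq → eq) (m≤n⇒m<n∨m≡n upper)

nonexistence : ∀ e₁ e₂ M → Exceptional M e₁ e₂ → ¬ GDP M e₁ e₂
nonexistence e₁ _ _ (residue , refl , refl) gdp =
  let K , fourK≡ = odd-differences-multiple e₁ gdp
      thrice≢0 , thrice+1≢0 = threefold-residues e₁ residue
  in Sum.[ thrice≢0 ∘ multiple-of-4 K , thrice+1≢0 ∘ multiple-of-4 K ] fourK≡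

corollary13 : (e₁ e₂ M : ℕ) → 6 * e₁ + 2 * e₂ + 1 ≤ M →
    (¬ Exceptional M e₁ e₂ → GDP M e₁ e₂) × (Exceptional M e₁ e₂ → ¬ GDP M e₁ e₂)
corollary13 e₁ e₂ M bound = existence e₁ e₂ M bound , nonexistence e₁ e₂ M
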